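{- Let $P\in\mathcal{U}(\mathfrak{gl}_k)$ be an element of length $L$, and suppose there is an algebraic circuit of size $s$ computing a metapolynomial $\Delta\colon\mathbb{C}[x_1,\dots,x_k]_d\to\mathbb{C}$. Then there exists an algebraic circuit of size $O\big(sL^{2k^2}\big)$ computing $P.\Delta$.
   Context: Metapolynomials are polynomials in variables $c_\mu$, $\mu\in\mathbb{N}^k$, $|\mu|=d$, evaluated at $f\in\mathbb{C}[x_1,\dots,x_k]_d$ by substituting for $c_\mu$ the coefficient of $x^\mu$ in $f$. The Lie algebra $\mathfrak{gl}_k$ (all $k\times k$ complex matrices, bracket $[X,Y]=XY-YX$) acts on metapolynomials by derivations: $E_{i,j}.\Delta=\sum_\mu(E_{i,j}.c_\mu)\partial\Delta/\partial c_\mu$, where $E_{i,j}$ are elementary matrices, $E_{i,j}.c_\mu=(\mu_i+1)c_{\mu+e_i-e_j}$ for $i\ne j$ (zero if $\mu_j=0$) and $E_{i,i}.c_\mu=\mu_ic_\mu$. The universal enveloping algebra $\mathcal{U}(\mathfrak{gl}_k)$ is the tensor algebra $\bigoplus_{m\ge0}\mathfrak{gl}_k^{\otimes m}$ modulo the ideal generated by $X\otimes Y-Y\otimes X-[X,Y]$; it acts by $(Y_1\cdots Y_\ell).\Delta=Y_1.(\cdots(Y_\ell.\Delta))$. The length of $P$ is the minimal $\ell$ such that $P$ is the image of an element of $\bigoplus_{m\le\ell}\mathfrak{gl}_k^{\otimes m}$. An algebraic circuit is a directed acyclic graph with a unique outdegree-$0$ vertex, indegree-$0$ vertices labelled by affine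 linear metapolynomials, indegree-$2$ vertices labelled $+$ or $\times$, and edges labelled by complex scalars; a gate computes $\alpha_1\Delta_1+\alpha_2\Delta_2$ or $\alpha_1\alpha_2\Delta_1\Delta_2$ from its children's values and edge labels, and the circuit computes the value at the output. Its size is its number of vertices. -}

module Defs where

open import Level using (0ℓ)
open import Algebra.Bundles using (CommutativeRing)
open import Data.Nat using (ℕ; zero; suc; pred; _≤_)
import Data.Nat as ℕ
open import Data.Fin using (Fin)
import Data.Fin as Fin
open import Data.Vec using (Vec; []; _∷_; lookup; updateAt; sum)
open import Data.List using (List; []; _∷_; length; foldr)
open import Data.List.Relation.Unary.All using (All)
open import Data.Product using (Σ; ∃; _×_; _,_)
open import Relation.Binary.PropositionalEquality using (_≡_)
open import Relation.Nullary using (¬_; yes; no)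

-- The ground field: a commutative ring which is a field of characteristic
-- zero and algebraically closed (stand-in for ℂ, which is not available).

module _ (R : CommutativeRing 0ℓ 0ℓ) where
  open CommutativeRing R

  natCast : ℕ → Carrier
  natCast zero    = 0#
  natCast (suc n) = 1# + natCast n

  pow : Carrier → ℕ → Carrier
  pow x zero    = 1#
  pow x (suc n) = x * pow x n

  horner : ∀ {m} → Vec Carrier m → Carrier → Carrier
  horner []       x = 0#
  horner (a ∷ as) x = a + x * horner as x

  record IsACF0 : Set where
    field
      nontrivial  : ¬ (1# ≈ 0#)
      inverse     : ∀ x → ¬ (x ≈ 0#) → ∃ λ y → x * y ≈ 1#
      charZero    : ∀ n → ¬ (n ≡ 0) → ¬ (natCast n ≈ 0#)
      algClosed   : ∀ n (a : Vec Carrier (suc n)) →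
                    ∃ λ x → (pow x (suc n) + horner a x) ≈ 0#

-- Formal polynomial expressions (metapolynomials) with constants in A
-- and variables in V.

data Expr (A V : Set) : Set where
  var  : V → Expr A V
  con  : A → Expr A V
  _⊕_  : Expr A V → Expr A V → Expr A V
  _⊗_  : Expr A V → Expr A V → Expr A V

-- Exponent vectors μ ∈ ℕ^k with |μ| = d : index set of the variables c_μ.
Mono : ℕ → ℕ → Set
Mono k d = Σ (Vec ℕ k) (λ μ → sum μ ≡ d)

module Meta (R : CommutativeRing 0ℓ 0ℓ) (k d : ℕ) where
  open CommutativeRing R

  MetaPoly : Set
  MetaPoly = Expr Carrier (Mono k d)

  -- value of a metapolynomial at f, where f is given by its coefficient
  -- vector c (c μ = coefficient of x^μ in f)
  eval : (Mono k d → Carrier) → MetaPoly → Carrier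
  eval c (var μ) = c μ
  eval c (con a) = a
  eval c (e ⊕ f) = eval c e + eval c f
  eval c (e ⊗ f) = eval c e * eval c f

  elemVar : Fin k → Fin k → Mono k d → MetaPoly
  elemVar i j (μ , p) with i Fin.≟ j
  ... | yes _ = con (natCast R (lookup μ i)) ⊗ var (μ , p)
  ... | no  _ with lookup μ j
  ...   | zero  = con 0#
  ...   | suc _ with updateAt (updateAt μ i suc) j pred
  ...     | μ' with sum μ' ℕ.≟ d
  ...       | yes q = con (natCast R (suc (lookup μ i))) ⊗ var (μ' , q)
  ...       | no  _ = con 0#   -- never happens: |μ + e_i − e_j| = d

  -- E_{i,j} acting as the derivation Σ_μ (E_{i,j}.c_μ) ∂/∂c_μ
  elemAct : Fin k → Fin k → MetaPoly → MetaPoly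
  elemAct i j (var μ) = elemVar i j μ
  elemAct i j (con a) = con 0#
  elemAct i j (e ⊕ f) = elemAct i j e ⊕ elemAct i j f
  elemAct i j (e ⊗ f) = (elemAct i j e ⊗ f) ⊕ (e ⊗ elemAct i j f)

  -- A word Y₁ ⋯ Y_ℓ in the elementary matrices; Y = (i , j) means E_{i,j}.
  Word : Set
  Word = List (Fin k × Fin k)

  wordAct : Word → MetaPoly → MetaPoly
  wordAct []            e = e
  wordAct ((i , j) ∷ w) e = elemAct i j (wordAct w e)

  -- A representative in ⊕_m gl_k^{⊗m} of an element of U(gl_k), written
  -- (after multilinear expansion in the basis E_{i,j}) as a finite linear
  -- combination of words.
  UEnvRep : Set
  UEnvRep = List (Carrier × Word)

  HasLength≤ : UEnvRep → ℕ → Set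
  HasLength≤ P L = All (λ aw → length (Data.Product.proj₂ aw) ≤ L) P

  uAct : UEnvRep → MetaPoly → MetaPoly
  uAct P e = foldr (λ aw acc → (con (Data.Product.proj₁ aw) ⊗ wordAct (Data.Product.proj₂ aw) e) ⊕ acc) (con 0#) P

  -- Algebraic circuits, as topologically sorted lists of vertices.
  -- A vertex with n earlier vertices is either a leaf labelled by an
  -- affine linear metapolynomial a₀ + Σ b_μ c_μ, or a +/× gate with two
  -- children among the earlier vertices and scalar edge labels α₁, α₂.

  data Gate (n : ℕ) : Set where
    leaf : Carrier → List (Carrier × Mono k d) → Gate n
    add  : Carrier → Fin n → Carrier → Fin n → Gate n
    mul  : Carrier → Fin n → Carrier → Fin n → Gate n

  data Circuit : ℕ → Set where
    []  : Circuit 0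
    _▷_ : ∀ {n} → Circuit n → Gate n → Circuit (suc n)

  affine : Carrier → List (Carrier × Mono k d) → MetaPoly
  affine a₀ bs = foldr (λ bμ acc → (con (Data.Product.proj₁ bμ) ⊗ var (Data.Product.proj₂ bμ)) ⊕ acc) (con a₀) bs

  values : ∀ {n} → Circuit n → Vec MetaPoly n
  values []       = []
  values (C ▷ g) = gateVal g (values C) ∷ values C
    where
    gateVal : ∀ {n} → Gate n → Vec MetaPoly n → MetaPoly
    gateVal (leaf a₀ bs)   vs = affine a₀ bs
    gateVal (add α x β y)  vs = (con α ⊗ lookup vs x) ⊕ (con β ⊗ lookup vs y)
    gateVal (mul α x β y)  vs = (con (α * β) ⊗ lookup vs x) ⊗ lookup vs y

  output : ∀ {n} → Circuit (suc n) → MetaPoly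
  output (C ▷ g) = Data.Vec.head (values (C ▷ g))

  -- C computes Δ (as a function on ℂ[x₁,…,x_k]_d, i.e. on coefficient vectors)
  Computes : ∀ {n} → Circuit (suc n) → MetaPoly → Set
  Computes C Δ = ∀ (c : Mono k d → Carrier) → eval c (output C) ≈ eval c Δ

module Submission where

-- Write P as a combination of words in the elementary matrices.  A word acts on metapolynomials
-- by composed derivations, so on a product it acts by the Leibniz rule, and the values w.Δ obey the
-- commutation relations of gl_k.  By Poincaré–Birkhoff–Witt straightening every word of length ≤ L
-- is a combination of ordered monomials E^κ = E₁^κ₁ ⋯ E_{k²}^κ_{k²} with |κ| ≤ L, and these are closed
-- under the Leibniz rule: E^κ.(ΔΓ) = Σ_{β+γ=κ} (κ choose β) (E^β.Δ)(E^γ.Γ).  Replacing each gate g of the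
-- circuit by gates computing all the jets E^κ.g therefore yields a circuit for P.Δ; a product gate
-- costs Σ_κ ∏ (κᵢ + 1) ≤ 2 L^{2k²} gates.  For L ≤ 1 the two jets Δ and P₁.Δ suffice, P₁ the degree-one part of P.

open import Level using (0ℓ)
open import Algebra.Bundles using (CommutativeRing)
import Algebra.Solver.CommutativeMonoid as CMSolver
open import Data.Empty using (⊥-elim)
open import Data.Fin as Fin using (Fin)
import Data.Fin.Properties as Finₚ
open import Data.List as List using (List; []; _∷_; _++_; concatMap)
import Data.List.Properties as Listₚ
open import Data.List.Membership.Propositional using (_∈_)
open import Data.List.Membership.Propositional.Properties using (∈-map⁺; ∈-concatMap⁺; ∈-lookup)
import Data.List.Membership.DecPropositional as DecMembership
open import Data.List.Relation.Unary.All as All using (All; []; _∷_)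
import Data.List.Relation.Unary.All.Properties as Allₚ
open import Data.List.Relation.Unary.Any as Any using (here; there)
import Data.List.Relation.Unary.Any.Properties as Anyₚ
open import Data.Nat as ℕ using (ℕ; zero; suc; z≤n; s≤s)
import Data.Nat.Properties as ℕₚ
open import Data.Nat.Tactic.RingSolver using (solve-∀)
open import Data.Product as Product using (Σ; ∃; _×_; _,_; proj₁; proj₂)
open import Data.Sum using ([_,_]′)
open import Data.Vec as Vec using (Vec; []; _∷_; lookup; updateAt)
import Data.Vec.Properties as Vecₚ
open import Function using (_∘_)
open import Relation.Binary.PropositionalEquality as ≡ using (_≡_; _≢_; refl)
open import Relation.Nullary using (yes; no)

open import Defs

module ExponentCounting where
  open import Data.Nat using (_+_; _*_; _∸_; _^_; _≤_)

  sum-updateAt : ∀ {n} (ν : Vec ℕ n) i (f : ℕ → ℕ) →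
                 Vec.sum (updateAt ν i f) + lookup ν i ≡ Vec.sum ν + f (lookup ν i)
  sum-updateAt (x ∷ ν) Fin.zero f = shuffle (f x) (Vec.sum ν) x
    where shuffle : ∀ a b c → (a + b) + c ≡ (c + b) + a
          shuffle = solve-∀
  sum-updateAt (x ∷ ν) (Fin.suc i) f = begin
    x + Vec.sum (updateAt ν i f) + lookup ν i   ≡⟨ ℕₚ.+-assoc x _ _ ⟩
    x + (Vec.sum (updateAt ν i f) + lookup ν i) ≡⟨ ≡.cong (x +_) (sum-updateAt ν i f) ⟩
    x + (Vec.sum ν + f (lookup ν i))            ≡⟨ ℕₚ.+-assoc x _ _ ⟨
    x + Vec.sum ν + f (lookup ν i)              ∎
    where open ≡.≡-Reasoning

  sum-updateAt-suc : ∀ {n} (ν : Vec ℕ n) i → Vec.sum (updateAt ν i suc) ≡ suc (Vec.sum ν)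
  sum-updateAt-suc ν i =
    ℕₚ.+-cancelʳ-≡ (lookup ν i) _ _ (≡.trans (sum-updateAt ν i suc) (ℕₚ.+-suc (Vec.sum ν) _))

  sum-updateAt-suc-pred : ∀ {n} (ν : Vec ℕ n) i j {t} → lookup ν j ≡ suc t →
                          Vec.sum (updateAt (updateAt ν j ℕ.pred) i suc) ≡ Vec.sum ν
  sum-updateAt-suc-pred ν i j {t} ν[j]≡1+t = ≡.trans (sum-updateAt-suc ν′ i) sum-pred
    where
    ν′ = updateAt ν j ℕ.pred
    sum-pred : suc (Vec.sum ν′) ≡ Vec.sum ν
    sum-pred = ℕₚ.+-cancelʳ-≡ t _ _ (≡.trans (≡.sym (ℕₚ.+-suc (Vec.sum ν′) t))
      (≡.subst (λ z → Vec.sum ν′ + z ≡ Vec.sum ν + ℕ.pred z) ν[j]≡1+t (sum-updateAt ν j ℕ.pred)))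

  updateAt-pred∘suc : ∀ {n} (ν : Vec ℕ n) i → updateAt (updateAt ν i suc) i ℕ.pred ≡ ν
  updateAt-pred∘suc ν i = ≡.trans (Vecₚ.updateAt-updateAt i ν) (Vecₚ.updateAt-id-local i ν refl)

  updateAt-suc∘pred : ∀ {n} (ν : Vec ℕ n) i {t} → lookup ν i ≡ suc t → updateAt (updateAt ν i ℕ.pred) i suc ≡ ν
  updateAt-suc∘pred ν i eq = ≡.trans (Vecₚ.updateAt-updateAt i ν)
    (Vecₚ.updateAt-id-local i ν (≡.trans (≡.cong (suc ∘ ℕ.pred) eq) (≡.sym eq)))

  sum-replicate-0 : ∀ n → Vec.sum (Vec.replicate n 0) ≡ 0
  sum-replicate-0 zero    = refl
  sum-replicate-0 (suc n) = sum-replicate-0 n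

  range : ℕ → List ℕ
  range zero    = 0 ∷ []
  range (suc B) = 0 ∷ List.map suc (range B)

  length-range : ∀ B → List.length (range B) ≡ suc B
  length-range zero    = refl
  length-range (suc B) = ≡.cong suc (≡.trans (Listₚ.length-map suc (range B)) (length-range B))

  range-≤ : ∀ B → All (_≤ B) (range B)
  range-≤ zero    = z≤n ∷ []
  range-≤ (suc B) = z≤n ∷ Allₚ.map⁺ (All.map s≤s (range-≤ B))

  ∈-range : ∀ {B a} → a ≤ B → a ∈ range B
  ∈-range {zero}  z≤n     = here refl
  ∈-range {suc B} z≤n     = here refl
  ∈-range {suc B} (s≤s h) = there (∈-map⁺ suc (∈-range h))

  exponents : (m B : ℕ) → List (Vec ℕ m)
  exponents zero    B = [] ∷ []
  exponents (suc m) B = concatMap (λ a → List.map (a ∷_) (exponents m (B ∸ a))) (range B)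

  sum-tail-≤ : ∀ {m B} a (κ : Vec ℕ m) → a + Vec.sum κ ≤ B → Vec.sum κ ≤ B ∸ a
  sum-tail-≤ a κ h = ℕₚ.≤-trans (ℕₚ.≤-reflexive (≡.sym (ℕₚ.m+n∸m≡n a (Vec.sum κ)))) (ℕₚ.∸-monoˡ-≤ a h)

  exponents-≤ : ∀ m B → All (λ κ → Vec.sum κ ≤ B) (exponents m B)
  exponents-≤ zero    B = z≤n ∷ []
  exponents-≤ (suc m) B = Allₚ.concat⁺ (Allₚ.map⁺ (All.map (λ {a} a≤B → Allₚ.map⁺
    (All.map (λ κ≤ → ℕₚ.≤-trans (ℕₚ.+-monoʳ-≤ a κ≤) (ℕₚ.≤-reflexive (ℕₚ.m+[n∸m]≡n a≤B)))
             (exponents-≤ m (B ∸ a)))) (range-≤ B)))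

  ∈-exponents : ∀ {m B} (κ : Vec ℕ m) → Vec.sum κ ≤ B → κ ∈ exponents m B
  ∈-exponents []      h = here refl
  ∈-exponents {suc m} {B} (a ∷ κ) h = ∈-concatMap⁺ (λ a → List.map (a ∷_) (exponents m (B ∸ a)))
    (Any.map (λ { refl → ∈-map⁺ (a ∷_) (∈-exponents κ (sum-tail-≤ a κ h)) })
             (∈-range (ℕₚ.≤-trans (ℕₚ.m≤m+n a _) h)))

  sumℕ : {A : Set} → List A → (A → ℕ) → ℕ
  sumℕ []       f = 0
  sumℕ (x ∷ xs) f = f x + sumℕ xs f

  sumℕ-++ : {A : Set} (xs ys : List A) (f : A → ℕ) → sumℕ (xs ++ ys) f ≡ sumℕ xs f + sumℕ ys f
  sumℕ-++ []       ys f = refl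
  sumℕ-++ (x ∷ xs) ys f = ≡.trans (≡.cong (f x +_) (sumℕ-++ xs ys f)) (≡.sym (ℕₚ.+-assoc (f x) _ _))

  sumℕ-map : {A B : Set} (h : A → B) (xs : List A) (f : B → ℕ) → sumℕ (List.map h xs) f ≡ sumℕ xs (f ∘ h)
  sumℕ-map h []       f = refl
  sumℕ-map h (x ∷ xs) f = ≡.cong (f (h x) +_) (sumℕ-map h xs f)

  sumℕ-concatMap : {A B : Set} (h : A → List B) (xs : List A) (f : B → ℕ) →
                   sumℕ (concatMap h xs) f ≡ sumℕ xs (λ a → sumℕ (h a) f)
  sumℕ-concatMap h []       f = refl
  sumℕ-concatMap h (x ∷ xs) f =
    ≡.trans (sumℕ-++ (h x) (concatMap h xs) f) (≡.cong (sumℕ (h x) f +_) (sumℕ-concatMap h xs f))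

  sumℕ-cong : {A : Set} (xs : List A) {f g : A → ℕ} → (∀ a → f a ≡ g a) → sumℕ xs f ≡ sumℕ xs g
  sumℕ-cong []       h = refl
  sumℕ-cong (x ∷ xs) h = ≡.cong₂ _+_ (h x) (sumℕ-cong xs h)

  sumℕ-mono : {A : Set} {Q : A → Set} {xs : List A} {f g : A → ℕ} →
              All Q xs → (∀ a → Q a → f a ≤ g a) → sumℕ xs f ≤ sumℕ xs g
  sumℕ-mono []                 h = z≤n
  sumℕ-mono {xs = x ∷ _} (q ∷ qs) h = ℕₚ.+-mono-≤ (h x q) (sumℕ-mono qs h)

  sumℕ-*ˡ : {A : Set} (xs : List A) (c : ℕ) (f : A → ℕ) → sumℕ xs (λ a → c * f a) ≡ c * sumℕ xs f
  sumℕ-*ˡ []       c f = ≡.sym (ℕₚ.*-zeroʳ c)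
  sumℕ-*ˡ (x ∷ xs) c f =
    ≡.trans (≡.cong (c * f x +_) (sumℕ-*ˡ xs c f)) (≡.sym (ℕₚ.*-distribˡ-+ c (f x) _))

  sumℕ-const : {A : Set} (xs : List A) (c : ℕ) → sumℕ xs (λ _ → c) ≡ List.length xs * c
  sumℕ-const []       c = refl
  sumℕ-const (x ∷ xs) c = ≡.cong (c +_) (sumℕ-const xs c)

  -- the number of ways of writing κ = β + γ with β, γ ∈ ℕ^m
  splitCount : ∀ {m} → Vec ℕ m → ℕ
  splitCount []      = 1
  splitCount (a ∷ κ) = suc a * splitCount κ

  splitCount-pos : ∀ {m} (κ : Vec ℕ m) → 1 ≤ splitCount κ
  splitCount-pos []      = ℕₚ.≤-refl
  splitCount-pos (a ∷ κ) = ℕₚ.*-mono-≤ (s≤s (z≤n {a})) (splitCount-pos κ)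

  splitTotal : ℕ → ℕ → ℕ
  splitTotal m B = sumℕ (exponents m B) splitCount

  splitTotal-suc : ∀ m B → splitTotal (suc m) B ≡ sumℕ (range B) (λ a → suc a * splitTotal m (B ∸ a))
  splitTotal-suc m B = ≡.trans (sumℕ-concatMap _ (range B) splitCount) (sumℕ-cong (range B) (λ a → begin
    sumℕ (List.map (a ∷_) (exponents m (B ∸ a))) splitCount  ≡⟨ sumℕ-map (a ∷_) (exponents m (B ∸ a)) splitCount ⟩
    sumℕ (exponents m (B ∸ a)) (λ κ → suc a * splitCount κ)  ≡⟨ sumℕ-*ˡ (exponents m (B ∸ a)) (suc a) splitCount ⟩
    suc a * splitTotal m (B ∸ a)                              ∎))
    where open ≡.≡-Reasoning

  2*sum-range-suc : ∀ B → 2 * sumℕ (range B) suc ≡ suc B * (2 + B)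
  2*sum-range-suc zero    = refl
  2*sum-range-suc (suc B) = begin
    2 * (1 + sumℕ (List.map suc (range B)) suc) ≡⟨ ≡.cong (λ z → 2 * (1 + z)) (sumℕ-map suc (range B) suc) ⟩
    2 * (1 + sumℕ (range B) (suc ∘ suc))
      ≡⟨ ≡.cong (λ z → 2 * (1 + z)) (≡.trans (sum-suc (range B)) (≡.cong (_+ sumℕ (range B) suc) (length-range B))) ⟩
    2 * (1 + (suc B + sumℕ (range B) suc))      ≡⟨ distribute B (sumℕ (range B) suc) ⟩
    2 * (2 + B) + 2 * sumℕ (range B) suc       ≡⟨ ≡.cong (2 * (2 + B) +_) (2*sum-range-suc B) ⟩
    2 * (2 + B) + suc B * (2 + B)              ≡⟨ identity B ⟩
    suc (suc B) * (2 + suc B)                  ∎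
    where
    open ≡.≡-Reasoning
    sum-suc : ∀ xs → sumℕ xs (suc ∘ suc) ≡ List.length xs + sumℕ xs suc
    sum-suc []       = refl
    sum-suc (x ∷ xs) = ≡.trans (≡.cong (suc (suc x) +_) (sum-suc xs)) (shift (List.length xs) x _)
      where shift : ∀ n x s → suc (suc x) + (n + s) ≡ suc (n + (suc x + s))
            shift = solve-∀
    distribute : ∀ B s → 2 * (1 + (suc B + s)) ≡ 2 * (2 + B) + 2 * s
    distribute = solve-∀
    identity : ∀ B → 2 * (2 + B) + suc B * (2 + B) ≡ suc (suc B) * (2 + suc B)
    identity = solve-∀

  4xy≤[x+y]² : ∀ x y → 4 * (x * y) ≤ (x + y) * (x + y)
  4xy≤[x+y]² x y = [ ordered , (λ y≤x → ≡.subst₂ _≤_ (≡.cong (4 *_) (ℕₚ.*-comm y x)) (≡.cong₂ _*_ (ℕₚ.+-comm y x) (ℕₚ.+-comm y x))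
                     (ordered y≤x)) ]′ (ℕₚ.≤-total x y)
    where
    ordered : ∀ {x y} → x ≤ y → 4 * (x * y) ≤ (x + y) * (x + y)
    ordered {x} {y} x≤y = ≡.subst (λ z → 4 * (x * z) ≤ (x + z) * (x + z)) (ℕₚ.m+[n∸m]≡n x≤y)
                                  (ℕₚ.m+n≤o⇒m≤o _ (ℕₚ.≤-reflexive (square x (y ∸ x))))
      where square : ∀ x t → 4 * (x * (x + t)) + t * t ≡ (x + (x + t)) * (x + (x + t))
            square = solve-∀

  *-^-distrib : ∀ a b n → (a * b) ^ n ≡ a ^ n * b ^ n
  *-^-distrib a b zero    = refl
  *-^-distrib a b (suc n) = ≡.trans (≡.cong ((a * b) *_) (*-^-distrib a b n)) (interchange a b (a ^ n) (b ^ n))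
    where interchange : ∀ a b x y → (a * b) * (x * y) ≡ (a * x) * (b * y)
          interchange = solve-∀

  -- The inner sum is a convolution; AM-GM bounds each term by a square of B + 2.
  splitTotal-invariant : ∀ m B → 2 ^ suc (2 * m) * splitTotal (suc m) B ≤ suc B * (2 + B) ^ suc (2 * m)
  splitTotal-invariant zero B = ℕₚ.≤-reflexive (begin
    2 * splitTotal 1 B                 ≡⟨ ≡.cong (2 *_) (≡.trans (splitTotal-suc 0 B) (sumℕ-cong (range B) (λ a → ℕₚ.*-identityʳ (suc a)))) ⟩
    2 * sumℕ (range B) suc             ≡⟨ 2*sum-range-suc B ⟩
    suc B * (2 + B)                    ≡⟨ ≡.cong (suc B *_) (ℕₚ.*-identityʳ (2 + B)) ⟨
    suc B * (2 + B) ^ 1                ∎)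
    where open ≡.≡-Reasoning
  splitTotal-invariant (suc m) B = begin
    2 ^ suc (2 * suc m) * splitTotal (suc (suc m)) B
      ≡⟨ ≡.cong₂ (λ x y → 2 ^ suc x * y) (ℕₚ.*-suc 2 m) (splitTotal-suc (suc m) B) ⟩
    2 * (2 * E) * sumℕ (range B) (λ a → suc a * splitTotal (suc m) (B ∸ a))
      ≡⟨ ≡.trans (sumℕ-cong (range B) (λ a → ≡.sym (regroup E (suc a) _))) (sumℕ-*ˡ (range B) (2 * (2 * E)) _) ⟨
    sumℕ (range B) (λ a → 4 * suc a * (E * splitTotal (suc m) (B ∸ a)))
      ≤⟨ sumℕ-mono (range-≤ B) (λ a _ → ℕₚ.*-monoʳ-≤ (4 * suc a) (splitTotal-invariant m (B ∸ a))) ⟩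
    sumℕ (range B) (λ a → 4 * suc a * (suc (B ∸ a) * (2 + (B ∸ a)) ^ e))
      ≤⟨ sumℕ-mono (range-≤ B) term-≤ ⟩
    sumℕ (range B) (λ _ → (2 + B) * (2 + B) * (2 + B) ^ e)
      ≡⟨ ≡.trans (sumℕ-const (range B) _) (≡.cong (_* ((2 + B) * (2 + B) * (2 + B) ^ e)) (length-range B)) ⟩
    suc B * ((2 + B) * (2 + B) * (2 + B) ^ e)
      ≡⟨ ≡.cong (λ z → suc B * z) (≡.trans (ℕₚ.*-assoc (2 + B) (2 + B) ((2 + B) ^ e)) (≡.cong (λ z → (2 + B) ^ suc z) (≡.sym (ℕₚ.*-suc 2 m)))) ⟩
    suc B * (2 + B) ^ suc (2 * suc m) ∎
    where
    open ℕₚ.≤-Reasoning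
    e = suc (2 * m)
    E = 2 ^ e
    regroup : ∀ E x V → 2 * (2 * E) * (x * V) ≡ 4 * x * (E * V)
    regroup = solve-∀
    term-≤ : ∀ a → a ≤ B → 4 * suc a * (suc (B ∸ a) * (2 + (B ∸ a)) ^ e) ≤ (2 + B) * (2 + B) * (2 + B) ^ e
    term-≤ a a≤B = ℕₚ.≤-trans (ℕₚ.≤-reflexive (reassoc (suc a) (suc (B ∸ a)) ((2 + (B ∸ a)) ^ e)))
      (ℕₚ.*-mono-≤ (≡.subst (λ z → 4 * (suc a * suc (B ∸ a)) ≤ z * z) sum≡ (4xy≤[x+y]² (suc a) (suc (B ∸ a))))
                   (ℕₚ.^-monoˡ-≤ e (ℕₚ.+-monoʳ-≤ 2 (ℕₚ.m∸n≤m B a))))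
      where
      reassoc : ∀ x y z → 4 * x * (y * z) ≡ 4 * (x * y) * z
      reassoc = solve-∀
      sum≡ : suc a + suc (B ∸ a) ≡ 2 + B
      sum≡ = ≡.trans (ℕₚ.+-suc (suc a) (B ∸ a)) (≡.cong (suc ∘ suc) (ℕₚ.m+[n∸m]≡n a≤B))

  splitTotal-≤ : ∀ m B → 2 ≤ B → splitTotal m B ≤ 2 * B ^ (2 * m)
  splitTotal-≤ zero    B 2≤B = s≤s z≤n
  splitTotal-≤ (suc m) B 2≤B = begin
    splitTotal (suc m) B  ≤⟨ ℕₚ.*-cancelˡ-≤ (2 ^ e) {{ℕₚ.m^n≢0 2 e}} scaled ⟩
    suc B * B ^ e         ≤⟨ ℕₚ.*-monoˡ-≤ (B ^ e) (ℕₚ.≤-trans (ℕₚ.+-monoˡ-≤ B (ℕₚ.≤-trans (s≤s z≤n) 2≤B)) (ℕₚ.≤-reflexive (double B))) ⟩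
    2 * B * B ^ e         ≡⟨ ≡.trans (ℕₚ.*-assoc 2 B _) (≡.cong (λ z → 2 * B ^ z) (≡.sym (ℕₚ.*-suc 2 m))) ⟩
    2 * B ^ (2 * suc m)   ∎
    where
    open ℕₚ.≤-Reasoning
    e = suc (2 * m)
    double : ∀ B → B + B ≡ 2 * B
    double = solve-∀
    scaled : 2 ^ e * splitTotal (suc m) B ≤ 2 ^ e * (suc B * B ^ e)
    scaled = begin
      2 ^ e * splitTotal (suc m) B  ≤⟨ splitTotal-invariant m B ⟩
      suc B * (2 + B) ^ e           ≤⟨ ℕₚ.*-monoʳ-≤ (suc B) (ℕₚ.^-monoˡ-≤ e (ℕₚ.≤-trans (ℕₚ.+-monoˡ-≤ B 2≤B) (ℕₚ.≤-reflexive (double B)))) ⟩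
      suc B * (2 * B) ^ e           ≡⟨ ≡.cong (suc B *_) (*-^-distrib 2 B e) ⟩
      suc B * (2 ^ e * B ^ e)       ≡⟨ ℕₚ.*-comm (suc B) _ ⟩
      2 ^ e * B ^ e * suc B         ≡⟨ ℕₚ.*-assoc (2 ^ e) _ _ ⟩
      2 ^ e * (B ^ e * suc B)       ≡⟨ ≡.cong (2 ^ e *_) (ℕₚ.*-comm (B ^ e) (suc B)) ⟩
      2 ^ e * (suc B * B ^ e)       ∎


  jet-size-arithmetic : ∀ t X → 0 ℕ.< X → suc (2 * X) + suc t * (3 * (2 * X)) ≤ 11 * (suc t * X)
  jet-size-arithmetic t X 0<X = begin
    suc (2 * X) + suc t * (3 * (2 * X))   ≤⟨ ℕₚ.+-monoˡ-≤ _ (ℕₚ.+-monoˡ-≤ (2 * X) 0<X) ⟩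
    X + 2 * X + suc t * (3 * (2 * X))     ≡⟨ regroup t X ⟩
    3 * X + 6 * (suc t * X)               ≤⟨ ℕₚ.+-monoˡ-≤ _ (ℕₚ.*-monoʳ-≤ 3 (ℕₚ.m≤n*m X (suc t))) ⟩
    3 * (suc t * X) + 6 * (suc t * X)     ≤⟨ ℕₚ.≤-trans (ℕₚ.≤-reflexive (nine (suc t * X))) (ℕₚ.m≤m+n _ (2 * (suc t * X))) ⟩
    9 * (suc t * X) + 2 * (suc t * X)     ≡⟨ eleven (suc t * X) ⟩
    11 * (suc t * X)                      ∎
    where
    open ℕₚ.≤-Reasoning
    regroup : ∀ t X → X + 2 * X + suc t * (3 * (2 * X)) ≡ 3 * X + 6 * (suc t * X)
    regroup = solve-∀
    nine : ∀ Y → 3 * Y + 6 * Y ≡ 9 * Y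
    nine = solve-∀
    eleven : ∀ Y → 9 * Y + 2 * Y ≡ 11 * Y
    eleven = solve-∀
open ExponentCounting

module Combinations (R : CommutativeRing 0ℓ 0ℓ) where
  open CommutativeRing R renaming (refl to ≈-refl; sym to ≈-sym; trans to ≈-trans)
  open import Relation.Binary.Reasoning.Setoid setoid
  open CMSolver +-commutativeMonoid using (solve; _⊜_) renaming (_⊕_ to _⊞_)

  ≡⇒≈ : ∀ {x y} → x ≡ y → x ≈ y
  ≡⇒≈ refl = ≈-refl

  +-interchange : ∀ a b c d → (a + b) + (c + d) ≈ (a + c) + (b + d)
  +-interchange = solve 4 (λ a b c d → ((a ⊞ b) ⊞ (c ⊞ d)) ⊜ ((a ⊞ c) ⊞ (b ⊞ d))) ≈-refl

  *-left-comm : ∀ a b c → a * (b * c) ≈ b * (a * c)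
  *-left-comm a b c = ≈-trans (≈-sym (*-assoc a b c)) (≈-trans (*-congʳ (*-comm a b)) (*-assoc b a c))

  Comb : Set → Set
  Comb A = List (Carrier × A)

  lincomb : {A : Set} → Comb A → (A → Carrier) → Carrier
  lincomb []             f = 0#
  lincomb ((α , a) ∷ xs) f = α * f a + lincomb xs f

  lincomb-cong : {A : Set} (xs : Comb A) {f g : A → Carrier} → (∀ a → f a ≈ g a) → lincomb xs f ≈ lincomb xs g
  lincomb-cong []             h = ≈-refl
  lincomb-cong ((α , a) ∷ xs) h = +-cong (*-congˡ (h a)) (lincomb-cong xs h)

  AllKeys : {A : Set} → (A → Set) → Comb A → Set
  AllKeys Q = All (Q ∘ proj₂)

  lincomb-congᴬ : {A : Set} {Q : A → Set} {xs : Comb A} {f g : A → Carrier} →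
                  AllKeys Q xs → (∀ a → Q a → f a ≈ g a) → lincomb xs f ≈ lincomb xs g
  lincomb-congᴬ []                           h = ≈-refl
  lincomb-congᴬ {xs = (α , a) ∷ _} (q ∷ qs) h = +-cong (*-congˡ (h a q)) (lincomb-congᴬ qs h)

  lincomb-+ : {A : Set} (xs : Comb A) (f g : A → Carrier) →
              lincomb xs (λ a → f a + g a) ≈ lincomb xs f + lincomb xs g
  lincomb-+ []             f g = ≈-sym (+-identityʳ 0#)
  lincomb-+ ((α , a) ∷ xs) f g = ≈-trans (+-cong (distribˡ α (f a) (g a)) (lincomb-+ xs f g)) (+-interchange _ _ _ _)

  lincomb-*ˡ : {A : Set} (xs : Comb A) (b : Carrier) (f : A → Carrier) →
               lincomb xs (λ a → b * f a) ≈ b * lincomb xs f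
  lincomb-*ˡ []             b f = ≈-sym (zeroʳ b)
  lincomb-*ˡ ((α , a) ∷ xs) b f =
    ≈-trans (+-cong (*-left-comm α b (f a)) (lincomb-*ˡ xs b f)) (≈-sym (distribˡ b _ _))

  lincomb-zero : {A : Set} (xs : Comb A) {f : A → Carrier} → (∀ a → f a ≈ 0#) → lincomb xs f ≈ 0#
  lincomb-zero []             h = ≈-refl
  lincomb-zero ((α , a) ∷ xs) h =
    ≈-trans (+-cong (≈-trans (*-congˡ (h a)) (zeroʳ α)) (lincomb-zero xs h)) (+-identityʳ 0#)

  lincomb-++ : {A : Set} (xs ys : Comb A) (f : A → Carrier) → lincomb (xs ++ ys) f ≈ lincomb xs f + lincomb ys f
  lincomb-++ []             ys f = ≈-sym (+-identityˡ _)
  lincomb-++ ((α , a) ∷ xs) ys f = ≈-trans (+-congˡ (lincomb-++ xs ys f)) (≈-sym (+-assoc _ _ _))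

  mapKeys : {A B : Set} → (A → B) → Comb A → Comb B
  mapKeys g = List.map (Product.map₂ g)

  lincomb-mapKeys : {A B : Set} (g : A → B) (xs : Comb A) (f : B → Carrier) → lincomb (mapKeys g xs) f ≡ lincomb xs (f ∘ g)
  lincomb-mapKeys g []             f = refl
  lincomb-mapKeys g ((α , a) ∷ xs) f = ≡.cong (α * f (g a) +_) (lincomb-mapKeys g xs f)

  AllKeys-mapKeys : {A B : Set} {Q : A → Set} {Q′ : B → Set} (g : A → B) →
                    (∀ {a} → Q a → Q′ (g a)) → {xs : Comb A} → AllKeys Q xs → AllKeys Q′ (mapKeys g xs)
  AllKeys-mapKeys g h qs = Allₚ.map⁺ (All.map h qs)

  scale : {A : Set} → Carrier → Comb A → Comb A
  scale α = List.map (Product.map₁ (α *_))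

  lincomb-scale : {A : Set} (α : Carrier) (xs : Comb A) (f : A → Carrier) → lincomb (scale α xs) f ≈ α * lincomb xs f
  lincomb-scale α []             f = ≈-sym (zeroʳ α)
  lincomb-scale α ((β , a) ∷ xs) f =
    ≈-trans (+-cong (*-assoc α β (f a)) (lincomb-scale α xs f)) (≈-sym (distribˡ α _ _))

  substitute : {A B : Set} → Comb A → (A → Comb B) → Comb B
  substitute []             g = []
  substitute ((α , a) ∷ xs) g = scale α (g a) ++ substitute xs g

  lincomb-substitute : {A B : Set} (xs : Comb A) (g : A → Comb B) (f : B → Carrier) →
                       lincomb (substitute xs g) f ≈ lincomb xs (λ a → lincomb (g a) f)
  lincomb-substitute []             g f = ≈-refl
  lincomb-substitute ((α , a) ∷ xs) g f =
    ≈-trans (lincomb-++ (scale α (g a)) (substitute xs g) f) (+-cong (lincomb-scale α (g a) f) (lincomb-substitute xs g f))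

  AllKeys-substitute : {A B : Set} {Q : A → Set} {Q′ : B → Set} {xs : Comb A} (g : A → Comb B) →
                       AllKeys Q xs → (∀ a → Q a → AllKeys Q′ (g a)) → AllKeys Q′ (substitute xs g)
  AllKeys-substitute g []                           h = []
  AllKeys-substitute {xs = (α , a) ∷ _} g (q ∷ qs) h =
    Allₚ.++⁺ (Allₚ.map⁺ (h a q)) (AllKeys-substitute g qs h)

  length-substitute : {A B : Set} (xs : Comb A) (g : A → Comb B) (n : ℕ) →
                      (∀ a → List.length (g a) ≡ n) → List.length (substitute xs g) ≡ List.length xs ℕ.* n
  length-substitute []             g n h = refl
  length-substitute ((α , a) ∷ xs) g n h =
    ≡.trans (Listₚ.length-++ (scale α (g a)))
            (≡.cong₂ ℕ._+_ (≡.trans (Listₚ.length-map _ (g a)) (h a)) (length-substitute xs g n h))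

  sumOver : {A : Set} → List A → (A → Carrier) → Carrier
  sumOver []       f = 0#
  sumOver (x ∷ xs) f = f x + sumOver xs f

  sumOver-cong : {A : Set} (xs : List A) {f g : A → Carrier} → (∀ a → f a ≈ g a) → sumOver xs f ≈ sumOver xs g
  sumOver-cong []       h = ≈-refl
  sumOver-cong (x ∷ xs) h = +-cong (h x) (sumOver-cong xs h)

  sumOver-+ : {A : Set} (xs : List A) (f g : A → Carrier) → sumOver xs (λ a → f a + g a) ≈ sumOver xs f + sumOver xs g
  sumOver-+ []       f g = ≈-sym (+-identityʳ 0#)
  sumOver-+ (x ∷ xs) f g = ≈-trans (+-congˡ (sumOver-+ xs f g)) (+-interchange _ _ _ _)

  sumOver-zero : {A : Set} (xs : List A) {f : A → Carrier} → (∀ a → f a ≈ 0#) → sumOver xs f ≈ 0#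
  sumOver-zero []       h = ≈-refl
  sumOver-zero (x ∷ xs) h = ≈-trans (+-cong (h x) (sumOver-zero xs h)) (+-identityʳ 0#)

  sumOver-++ : {A : Set} (xs ys : List A) (f : A → Carrier) → sumOver (xs ++ ys) f ≈ sumOver xs f + sumOver ys f
  sumOver-++ []       ys f = ≈-sym (+-identityˡ _)
  sumOver-++ (x ∷ xs) ys f = ≈-trans (+-congˡ (sumOver-++ xs ys f)) (≈-sym (+-assoc _ _ _))

  sumOver-map : {A B : Set} (h : A → B) (xs : List A) (f : B → Carrier) → sumOver (List.map h xs) f ≡ sumOver xs (f ∘ h)
  sumOver-map h []       f = refl
  sumOver-map h (x ∷ xs) f = ≡.cong (f (h x) +_) (sumOver-map h xs f)

  sumOver-concatMap : {A B : Set} (h : A → List B) (xs : List A) (f : B → Carrier) →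
                      sumOver (concatMap h xs) f ≈ sumOver xs (λ a → sumOver (h a) f)
  sumOver-concatMap h []       f = ≈-refl
  sumOver-concatMap h (x ∷ xs) f =
    ≈-trans (sumOver-++ (h x) (concatMap h xs) f) (+-congˡ (sumOver-concatMap h xs f))

  -- δ k κ α is α when k = κ and 0 otherwise.  Merging a combination onto a list Ks of keys,
  -- each of its keys occurring in Ks exactly once, bounds its length by that of Ks.
  module Merge {K : Set} (δ : K → K → Carrier → Carrier) where
    coefficient : Comb K → K → Carrier
    coefficient []             κ = 0#
    coefficient ((α , k) ∷ xs) κ = δ k κ α + coefficient xs κ

    merge : Comb K → List K → Comb K
    merge xs Ks = List.map (λ κ → coefficient xs κ , κ) Ks

    SelectsOnce : List K → K → Set
    SelectsOnce Ks k = ∀ (α : Carrier) (g : K → Carrier) → sumOver Ks (λ κ → δ k κ α * g κ) ≈ α * g k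

    lincomb-keyed : (Ks : List K) (c g : K → Carrier) → lincomb (List.map (λ κ → c κ , κ) Ks) g ≡ sumOver Ks (λ κ → c κ * g κ)
    lincomb-keyed []       c g = refl
    lincomb-keyed (κ ∷ Ks) c g = ≡.cong (c κ * g κ +_) (lincomb-keyed Ks c g)

    lincomb-merge : ∀ xs Ks g → AllKeys (SelectsOnce Ks) xs → lincomb (merge xs Ks) g ≈ lincomb xs g
    lincomb-merge [] Ks g [] =
      ≈-trans (≡⇒≈ (lincomb-keyed Ks _ g)) (sumOver-zero Ks (λ κ → zeroˡ (g κ)))
    lincomb-merge ((α , k) ∷ xs) Ks g (once ∷ onces) = begin
      lincomb (merge ((α , k) ∷ xs) Ks) g                                ≈⟨ ≡⇒≈ (lincomb-keyed Ks _ g) ⟩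
      sumOver Ks (λ κ → (δ k κ α + coefficient xs κ) * g κ)              ≈⟨ sumOver-cong Ks (λ κ → distribʳ (g κ) _ _) ⟩
      sumOver Ks (λ κ → δ k κ α * g κ + coefficient xs κ * g κ)          ≈⟨ sumOver-+ Ks _ _ ⟩
      sumOver Ks (λ κ → δ k κ α * g κ) + sumOver Ks (λ κ → coefficient xs κ * g κ)
        ≈⟨ +-cong (once α g) (≈-trans (≡⇒≈ (≡.sym (lincomb-keyed Ks (coefficient xs) g))) (lincomb-merge xs Ks g onces)) ⟩
      α * g k + lincomb xs g                                             ∎

    AllKeys-merge : {Q : K → Set} (xs : Comb K) {Ks : List K} → All Q Ks → AllKeys Q (merge xs Ks)
    AllKeys-merge xs qs = Allₚ.map⁺ qs

  δℕ : ℕ → ℕ → Carrier → Carrier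
  δℕ zero    zero    x = x
  δℕ zero    (suc _) x = 0#
  δℕ (suc _) zero    x = 0#
  δℕ (suc i) (suc a) x = δℕ i a x

  δℕ-refl : ∀ i x → δℕ i i x ≡ x
  δℕ-refl zero    x = refl
  δℕ-refl (suc i) x = δℕ-refl i x

  δℕ-*ʳ : ∀ i a x y → δℕ i a x * y ≈ δℕ i a (x * y)
  δℕ-*ʳ zero    zero    x y = ≈-refl
  δℕ-*ʳ zero    (suc a) x y = zeroˡ y
  δℕ-*ʳ (suc i) zero    x y = zeroˡ y
  δℕ-*ʳ (suc i) (suc a) x y = δℕ-*ʳ i a x y

  sumOver-δℕ : {A : Set} (i a : ℕ) (xs : List A) (f : A → Carrier) → sumOver xs (λ z → δℕ i a (f z)) ≈ δℕ i a (sumOver xs f)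
  sumOver-δℕ zero    zero    xs f = ≈-refl
  sumOver-δℕ zero    (suc a) xs f = sumOver-zero xs (λ _ → ≈-refl)
  sumOver-δℕ (suc i) zero    xs f = sumOver-zero xs (λ _ → ≈-refl)
  sumOver-δℕ (suc i) (suc a) xs f = sumOver-δℕ i a xs f

  sumOver-range-δℕ : ∀ {B i} → i ℕ.≤ B → ∀ (X : ℕ → Carrier) → sumOver (range B) (λ a → δℕ i a (X a)) ≈ X i
  sumOver-range-δℕ {zero}  z≤n X = +-identityʳ _
  sumOver-range-δℕ {suc B} z≤n X =
    ≈-trans (+-congˡ (≈-trans (≡⇒≈ (sumOver-map suc (range B) _)) (sumOver-zero (range B) (λ _ → ≈-refl)))) (+-identityʳ _)
  sumOver-range-δℕ {suc B} (s≤s i≤B) X =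
    ≈-trans (+-identityˡ _) (≈-trans (≡⇒≈ (sumOver-map suc (range B) _)) (sumOver-range-δℕ i≤B (X ∘ suc)))

  δℕ² : ℕ × ℕ → ℕ × ℕ → Carrier → Carrier
  δℕ² (i , j) (a , b) x = δℕ i a (δℕ j b x)

  δVec : ∀ {n} → Vec ℕ n → Vec ℕ n → Carrier → Carrier
  δVec []       []       x = x
  δVec (i ∷ is) (a ∷ as) x = δℕ i a (δVec is as x)

  module MergeExponents {m : ℕ} = Merge {Vec ℕ m} δVec

  exponents-selectsOnce : ∀ m B (κ : Vec ℕ m) → Vec.sum κ ℕ.≤ B → MergeExponents.SelectsOnce (exponents m B) κ
  exponents-selectsOnce zero    B []       h α g = +-identityʳ _
  exponents-selectsOnce (suc m) B (a ∷ κ) h α g = begin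
    sumOver (exponents (suc m) B) (λ z → δVec (a ∷ κ) z α * g z)
      ≈⟨ sumOver-concatMap _ (range B) _ ⟩
    sumOver (range B) (λ b → sumOver (List.map (b ∷_) (exponents m (B ℕ.∸ b))) (λ z → δVec (a ∷ κ) z α * g z))
      ≈⟨ sumOver-cong (range B) (λ b → ≈-trans (≡⇒≈ (sumOver-map (b ∷_) (exponents m (B ℕ.∸ b)) _))
           (≈-trans (sumOver-cong (exponents m (B ℕ.∸ b)) (λ z → δℕ-*ʳ a b _ _)) (sumOver-δℕ a b (exponents m (B ℕ.∸ b)) _))) ⟩
    sumOver (range B) (λ b → δℕ a b (sumOver (exponents m (B ℕ.∸ b)) (λ z → δVec κ z α * g (b ∷ z))))
      ≈⟨ sumOver-range-δℕ (ℕₚ.≤-trans (ℕₚ.m≤m+n a _) h) _ ⟩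
    sumOver (exponents m (B ℕ.∸ a)) (λ z → δVec κ z α * g (a ∷ z))
      ≈⟨ exponents-selectsOnce m (B ℕ.∸ a) κ (sum-tail-≤ a κ h) α (g ∘ (a ∷_)) ⟩
    α * g (a ∷ κ) ∎

module CoefficientAction (R : CommutativeRing 0ℓ 0ℓ) where
  open CommutativeRing R renaming (refl to ≈-refl; sym to ≈-sym; trans to ≈-trans)
  open import Relation.Binary.Reasoning.Setoid setoid
  open import Algebra.Properties.Ring ring using (-1*x≈-x; -0#≈0#)
  open Combinations R

  δFin : ∀ {n} → Fin n → Fin n → Carrier → Carrier
  δFin a b x with a Fin.≟ b
  ... | yes _ = x
  ... | no  _ = 0#

  δFin-cong : ∀ {n} (a b : Fin n) {x y} → x ≈ y → δFin a b x ≈ δFin a b y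
  δFin-cong a b h with a Fin.≟ b
  ... | yes _ = h
  ... | no  _ = ≈-refl

  δFin-neg : ∀ {n} (a b : Fin n) y → δFin a b (- 1# * y) ≈ - δFin a b y
  δFin-neg a b y with a Fin.≟ b
  ... | yes _ = -1*x≈-x y
  ... | no  _ = ≈-sym -0#≈0#

  consIf : ∀ {n} {A : Set} → Fin n → Fin n → A → Carrier → Comb A → Comb A
  consIf a b y α rest with a Fin.≟ b
  ... | yes _ = (α , y) ∷ rest
  ... | no  _ = rest

  lincomb-consIf : ∀ {n} {A : Set} (a b : Fin n) (y : A) (α : Carrier) (rest : Comb A) (f : A → Carrier) →
                   lincomb (consIf a b y α rest) f ≈ δFin a b (α * f y) + lincomb rest f
  lincomb-consIf a b y α rest f with a Fin.≟ b
  ... | yes _ = ≈-refl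
  ... | no  _ = ≈-sym (+-identityˡ _)

  CoeffFun : ℕ → Set
  CoeffFun n = Vec ℕ n → Carrier

  ifPositive : ℕ → Carrier → Carrier
  ifPositive zero    _ = 0#
  ifPositive (suc _) x = x

  raise : ∀ {n} → Fin n → CoeffFun n → CoeffFun n
  raise i G ν = natCast R (suc (lookup ν i)) * G (updateAt ν i suc)

  lower : ∀ {n} → Fin n → CoeffFun n → CoeffFun n
  lower j G ν = ifPositive (lookup ν j) (G (updateAt ν j ℕ.pred))

  -- E_{i,j}.c_ν = glOp (i , j) c ν, reading ν ↦ c_ν as a coefficient function
  glOp : ∀ {n} → Fin n × Fin n → CoeffFun n → CoeffFun n
  glOp (i , j) G = lower j (raise i G)

  record IsLinearOp {n} (O : CoeffFun n → CoeffFun n) : Set where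
    field
      cong   : ∀ {G G′} → (∀ ν → G ν ≈ G′ ν) → ∀ ν → O G ν ≈ O G′ ν
      +-homo : ∀ G G′ ν → O (λ μ → G μ + G′ μ) ν ≈ O G ν + O G′ ν
      *-homo : ∀ a G ν → O (λ μ → a * G μ) ν ≈ a * O G ν
  open IsLinearOp

  linearOp-zero : ∀ {n} {O : CoeffFun n → CoeffFun n} → IsLinearOp O → ∀ ν → O (λ _ → 0#) ν ≈ 0#
  linearOp-zero {O = O} lin ν = begin
    O (λ _ → 0#) ν       ≈⟨ cong lin (λ μ → ≈-sym (zeroˡ 0#)) ν ⟩
    O (λ _ → 0# * 0#) ν  ≈⟨ *-homo lin 0# (λ _ → 0#) ν ⟩
    0# * O (λ _ → 0#) ν  ≈⟨ zeroˡ _ ⟩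
    0#                   ∎

  linearOp-lincomb : ∀ {n} {O : CoeffFun n → CoeffFun n} {A : Set} → IsLinearOp O → (xs : Comb A) (Φ : A → CoeffFun n) →
                     ∀ ν → O (λ μ → lincomb xs (λ y → Φ y μ)) ν ≈ lincomb xs (λ y → O (Φ y) ν)
  linearOp-lincomb lin []             Φ ν = linearOp-zero lin ν
  linearOp-lincomb lin ((α , a) ∷ xs) Φ ν =
    ≈-trans (+-homo lin _ _ ν) (+-cong (*-homo lin α (Φ a) ν) (linearOp-lincomb lin xs Φ ν))

  linearOp-δFin : ∀ {n m} {O : CoeffFun n → CoeffFun n} → IsLinearOp O → (a b : Fin m) (G : CoeffFun n) →
                  ∀ ν → O (λ μ → δFin a b (G μ)) ν ≈ δFin a b (O G ν)
  linearOp-δFin lin a b G ν with a Fin.≟ b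
  ... | yes _ = ≈-refl
  ... | no  _ = linearOp-zero lin ν

  raise-linear : ∀ {n} (i : Fin n) → IsLinearOp (raise i)
  raise-linear i = record
    { cong   = λ h ν → *-congˡ (h _)
    ; +-homo = λ G G′ ν → distribˡ _ _ _
    ; *-homo = λ a G ν → *-left-comm _ a _
    }

  lower-linear : ∀ {n} (j : Fin n) → IsLinearOp (lower j)
  lower-linear j = record
    { cong   = λ h ν → ifPositive-cong (lookup ν j) (h _)
    ; +-homo = λ G G′ ν → ifPositive-+ (lookup ν j)
    ; *-homo = λ a G ν → ifPositive-* a (lookup ν j)
    }
    where
    ifPositive-cong : ∀ n {x y} → x ≈ y → ifPositive n x ≈ ifPositive n y
    ifPositive-cong zero    h = ≈-refl
    ifPositive-cong (suc n) h = h
    ifPositive-+ : ∀ n {x y} → ifPositive n (x + y) ≈ ifPositive n x + ifPositive n y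
    ifPositive-+ zero    = ≈-sym (+-identityʳ 0#)
    ifPositive-+ (suc n) = ≈-refl
    ifPositive-* : ∀ a n {x} → ifPositive n (a * x) ≈ a * ifPositive n x
    ifPositive-* a zero    = ≈-sym (zeroʳ a)
    ifPositive-* a (suc n) = ≈-refl

  ∘-linear : ∀ {n} {O O′ : CoeffFun n → CoeffFun n} → IsLinearOp O → IsLinearOp O′ → IsLinearOp (λ G → O (O′ G))
  ∘-linear lin lin′ = record
    { cong   = λ h → cong lin (cong lin′ h)
    ; +-homo = λ G G′ ν → ≈-trans (cong lin (+-homo lin′ G G′) ν) (+-homo lin _ _ ν)
    ; *-homo = λ a G ν → ≈-trans (cong lin (*-homo lin′ a G) ν) (*-homo lin a _ ν)
    }

  glOp-linear : ∀ {n} (x : Fin n × Fin n) → IsLinearOp (glOp x)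
  glOp-linear (i , j) = ∘-linear (lower-linear j) (raise-linear i)

  raise-comm : ∀ {n} (i a : Fin n) G ν → raise i (raise a G) ν ≈ raise a (raise i G) ν
  raise-comm i a G ν with i Fin.≟ a
  ... | yes refl = ≈-refl
  ... | no  i≢a rewrite Vecₚ.lookup∘updateAt′ a i {suc} (i≢a ∘ ≡.sym) ν | Vecₚ.lookup∘updateAt′ i a {suc} i≢a ν
                      | Vecₚ.updateAt-commutes i a {suc} {suc} i≢a ν = *-left-comm _ _ _

  lower-comm : ∀ {n} (j b : Fin n) G ν → lower j (lower b G) ν ≈ lower b (lower j G) ν
  lower-comm j b G ν with j Fin.≟ b
  ... | yes refl = ≈-refl
  ... | no  j≢b rewrite Vecₚ.lookup∘updateAt′ b j {ℕ.pred} (j≢b ∘ ≡.sym) ν | Vecₚ.lookup∘updateAt′ j b {ℕ.pred} j≢b ν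
                      | Vecₚ.updateAt-commutes j b {ℕ.pred} {ℕ.pred} j≢b ν = ifPositive-comm (lookup ν j) (lookup ν b)
    where
    ifPositive-comm : ∀ p q {x} → ifPositive p (ifPositive q x) ≈ ifPositive q (ifPositive p x)
    ifPositive-comm zero    zero    = ≈-refl
    ifPositive-comm zero    (suc q) = ≈-refl
    ifPositive-comm (suc p) zero    = ≈-refl
    ifPositive-comm (suc p) (suc q) = ≈-refl

  -- the canonical commutation relation [∂, x] = 1 in disguise
  raise-lower : ∀ {n} (i j : Fin n) G ν → raise i (lower j G) ν ≈ lower j (raise i G) ν + δFin i j (G ν)
  raise-lower i j G ν with i Fin.≟ j
  raise-lower i .i G ν | yes refl rewrite Vecₚ.lookup∘updateAt i {suc} ν | updateAt-pred∘suc ν i with lookup ν i in eq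
  ... | zero  = ≈-trans (*-congʳ (+-identityʳ 1#)) (≈-trans (*-identityˡ _) (≈-sym (+-identityˡ _)))
  ... | suc t rewrite Vecₚ.lookup∘updateAt i {ℕ.pred} ν | eq | updateAt-suc∘pred ν i eq =
        ≈-trans (distribʳ _ _ _) (≈-trans (+-comm _ _) (+-congˡ (*-identityˡ _)))
  raise-lower i j G ν | no i≢j rewrite Vecₚ.lookup∘updateAt′ j i {suc} (i≢j ∘ ≡.sym) ν
                                     | Vecₚ.lookup∘updateAt′ i j {ℕ.pred} i≢j ν
                                     | Vecₚ.updateAt-commutes i j {suc} {ℕ.pred} i≢j ν with lookup ν j
  ... | zero  = ≈-trans (zeroʳ _) (≈-sym (+-identityʳ 0#))
  ... | suc t = ≈-sym (+-identityʳ _)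

  -- [E_{i,j}, E_{a,b}] in the convention of the right action: words are applied left to right
  glBracket : ∀ {n} → Fin n × Fin n → Fin n × Fin n → Comb (Fin n × Fin n)
  glBracket (i , j) (a , b) = consIf i b (a , j) 1# (consIf a j (i , b) (- 1#) [])

  glOp-commutator : ∀ {n} (x y : Fin n × Fin n) G ν →
                    glOp x (glOp y G) ν ≈ glOp y (glOp x G) ν + lincomb (glBracket x y) (λ z → glOp z G ν)
  glOp-commutator (i , j) (a , b) G ν = begin
    lower j (raise i (lower b (raise a G))) ν
      ≈⟨ cong (lower-linear j) (raise-lower i b (raise a G)) ν ⟩
    lower j (λ μ → lower b (raise i (raise a G)) μ + δFin i b (raise a G μ)) ν
      ≈⟨ +-homo (lower-linear j) (lower b (raise i (raise a G))) (λ μ → δFin i b (raise a G μ)) ν ⟩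
    lower j (lower b (raise i (raise a G))) ν + lower j (λ μ → δFin i b (raise a G μ)) ν
      ≈⟨ +-cong (≈-trans (lower-comm j b (raise i (raise a G)) ν) (cong (∘-linear (lower-linear b) (lower-linear j)) (raise-comm i a G) ν))
                (linearOp-δFin (lower-linear j) i b (raise a G) ν) ⟩
    A + δFin i b (glOp (a , j) G ν)
      ≈⟨ add-and-subtract ⟩
    (A + δFin a j (glOp (i , b) G ν)) + (δFin i b (glOp (a , j) G ν) + (- δFin a j (glOp (i , b) G ν) + 0#))
      ≈⟨ +-cong (+-congˡ (≈-sym (linearOp-δFin (lower-linear b) a j (raise i G) ν)))
                (+-cong (≈-sym (δFin-cong i b (*-identityˡ _))) (+-congʳ (≈-sym (δFin-neg a j _)))) ⟩
    (A + lower b (λ μ → δFin a j (raise i G μ)) ν) + (δFin i b (1# * glOp (a , j) G ν) + (δFin a j (- 1# * glOp (i , b) G ν) + 0#))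
      ≈⟨ +-cong (≈-sym (+-homo (lower-linear b) (lower j (raise a (raise i G))) (λ μ → δFin a j (raise i G μ)) ν))
                (≈-sym (≈-trans (lincomb-consIf i b (a , j) 1# _ _) (+-congˡ (lincomb-consIf a j (i , b) (- 1#) [] _)))) ⟩
    lower b (λ μ → lower j (raise a (raise i G)) μ + δFin a j (raise i G μ)) ν + lincomb (glBracket (i , j) (a , b)) (λ z → glOp z G ν)
      ≈⟨ +-congʳ (≈-sym (cong (lower-linear b) (raise-lower a j (raise i G)) ν)) ⟩
    lower b (raise a (lower j (raise i G))) ν + lincomb (glBracket (i , j) (a , b)) (λ z → glOp z G ν) ∎
    where
    A = lower b (lower j (raise a (raise i G))) ν
    add-and-subtract : ∀ {B C} → A + B ≈ (A + C) + (B + (- C + 0#))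
    add-and-subtract {B} {C} = begin
      A + B                    ≈⟨ ≈-sym (+-identityʳ _) ⟩
      (A + B) + 0#             ≈⟨ +-congˡ (≈-sym (-‿inverseʳ C)) ⟩
      (A + B) + (C + - C)      ≈⟨ +-interchange A B C (- C) ⟩
      (A + C) + (B + - C)      ≈⟨ +-congˡ (+-congˡ (≈-sym (+-identityʳ _))) ⟩
      (A + C) + (B + (- C + 0#)) ∎

module LeibnizCoefficients (R : CommutativeRing 0ℓ 0ℓ) where
  open CommutativeRing R renaming (refl to ≈-refl; sym to ≈-sym; trans to ≈-trans)
  open import Relation.Binary.Reasoning.Setoid setoid
  open Combinations R

  -- one term (i , j) with i + j = n for each of the 2ⁿ ways of distributing n derivations over two factors
  binomialExpansion : ℕ → Comb (ℕ × ℕ)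
  binomialExpansion zero    = (1# , (0 , 0)) ∷ []
  binomialExpansion (suc n) =
    mapKeys (Product.map₁ suc) (binomialExpansion n) ++ mapKeys (Product.map₂ suc) (binomialExpansion n)

  binomialExpansion-keys : ∀ n → AllKeys (λ ij → proj₁ ij ℕ.+ proj₂ ij ≡ n) (binomialExpansion n)
  binomialExpansion-keys zero    = refl ∷ []
  binomialExpansion-keys (suc n) =
    Allₚ.++⁺ (AllKeys-mapKeys _ (≡.cong suc) (binomialExpansion-keys n))
             (AllKeys-mapKeys _ (λ {ij} h → ≡.trans (ℕₚ.+-suc (proj₁ ij) (proj₂ ij)) (≡.cong suc h)) (binomialExpansion-keys n))

  module MergeSplits = Merge δℕ²

  splits : ℕ → List (ℕ × ℕ)
  splits n = List.map (λ a → a , n ℕ.∸ a) (range n)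

  splits-selectsOnce : ∀ n i j → i ℕ.+ j ≡ n → MergeSplits.SelectsOnce (splits n) (i , j)
  splits-selectsOnce n i j i+j≡n α g = begin
    sumOver (splits n) (λ κ → δℕ² (i , j) κ α * g κ)
      ≈⟨ ≡⇒≈ (sumOver-map _ (range n) _) ⟩
    sumOver (range n) (λ a → δℕ i a (δℕ j (n ℕ.∸ a) α) * g (a , n ℕ.∸ a))
      ≈⟨ sumOver-cong (range n) (λ a → δℕ-*ʳ i a _ _) ⟩
    sumOver (range n) (λ a → δℕ i a (δℕ j (n ℕ.∸ a) α * g (a , n ℕ.∸ a)))
      ≈⟨ sumOver-range-δℕ (ℕₚ.≤-trans (ℕₚ.m≤m+n i j) (ℕₚ.≤-reflexive i+j≡n)) _ ⟩
    δℕ j (n ℕ.∸ i) α * g (i , n ℕ.∸ i)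
      ≡⟨ ≡.subst (λ z → δℕ j z α * g (i , z) ≡ α * g (i , j)) (≡.sym n∸i≡j) (≡.cong (_* g (i , j)) (δℕ-refl j α)) ⟩
    α * g (i , j) ∎
    where
    n∸i≡j : n ℕ.∸ i ≡ j
    n∸i≡j = ≡.trans (≡.cong (ℕ._∸ i) (≡.sym i+j≡n)) (ℕₚ.m+n∸m≡n i j)

  -- the binomial coefficients, as a combination with n + 1 terms
  binomialTerms : ℕ → Comb (ℕ × ℕ)
  binomialTerms n = MergeSplits.merge (binomialExpansion n) (splits n)

  lincomb-binomialTerms : ∀ n g → lincomb (binomialTerms n) g ≈ lincomb (binomialExpansion n) g
  lincomb-binomialTerms n g = MergeSplits.lincomb-merge (binomialExpansion n) (splits n) g
    (All.map (λ {αij} → splits-selectsOnce n (proj₁ (proj₂ αij)) (proj₂ (proj₂ αij))) (binomialExpansion-keys n))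

  binomialTerms-keys : ∀ n → AllKeys (λ ij → proj₁ ij ℕ.+ proj₂ ij ≡ n) (binomialTerms n)
  binomialTerms-keys n = MergeSplits.AllKeys-merge (binomialExpansion n)
    (Allₚ.map⁺ (All.map (λ a≤n → ℕₚ.m+[n∸m]≡n a≤n) (range-≤ n)))

  length-binomialTerms : ∀ n → List.length (binomialTerms n) ≡ suc n
  length-binomialTerms n =
    ≡.trans (Listₚ.length-map _ (splits n)) (≡.trans (Listₚ.length-map _ (range n)) (length-range n))

  leibnizTerms : ∀ {m} → Vec ℕ m → Comb (Vec ℕ m × Vec ℕ m)
  leibnizTerms []       = (1# , ([] , [])) ∷ []
  leibnizTerms (e ∷ es) = substitute (binomialTerms e) (λ ij →
    mapKeys (Product.zip _∷_ _∷_ ij) (leibnizTerms es))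

  leibnizTerms-degree : ∀ {m} (es : Vec ℕ m) →
                        AllKeys (λ βγ → Vec.sum (proj₁ βγ) ℕ.+ Vec.sum (proj₂ βγ) ≡ Vec.sum es) (leibnizTerms es)
  leibnizTerms-degree []       = refl ∷ []
  leibnizTerms-degree (e ∷ es) = AllKeys-substitute _ (binomialTerms-keys e) (λ ij i+j≡e →
    AllKeys-mapKeys _ (λ {βγ} h → ≡.trans (interchange (proj₁ ij) (proj₂ ij) (Vec.sum (proj₁ βγ)) (Vec.sum (proj₂ βγ)))
                                           (≡.cong₂ ℕ._+_ i+j≡e h))
                      (leibnizTerms-degree es))
    where interchange : ∀ a b c d → (a ℕ.+ c) ℕ.+ (b ℕ.+ d) ≡ (a ℕ.+ b) ℕ.+ (c ℕ.+ d)
          interchange = solve-∀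

  length-leibnizTerms : ∀ {m} (es : Vec ℕ m) → List.length (leibnizTerms es) ≡ splitCount es
  length-leibnizTerms []       = refl
  length-leibnizTerms (e ∷ es) = ≡.trans
    (length-substitute (binomialTerms e) _ (splitCount es) (λ ij → ≡.trans (Listₚ.length-map _ (leibnizTerms es)) (length-leibnizTerms es)))
    (≡.cong (ℕ._* splitCount es) (length-binomialTerms e))

-- A family F stands for w ↦ (w.Δ)(f) at a fixed f, for words w in the basis X of a Lie algebra acting by
-- derivations; `bracket` gives its structure constants.
module WordFamilies (R : CommutativeRing 0ℓ 0ℓ) {X : Set} (bracket : X → X → Combinations.Comb R X) where
  open CommutativeRing R renaming (refl to ≈-refl; sym to ≈-sym; trans to ≈-trans)
  open import Relation.Binary.Reasoning.Setoid setoid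
  open CMSolver +-commutativeMonoid using (solve; _⊜_) renaming (_⊕_ to _⊞_)
  open Combinations R
  open LeibnizCoefficients R

  Word : Set
  Word = List X

  Family : Set
  Family = Word → Carrier

  shift : X → Family → Family
  shift x F w = F (x ∷ w)

  RespectsBracket : Family → Set
  RespectsBracket F = ∀ u a b v → F (u ++ a ∷ b ∷ v) ≈ F (u ++ b ∷ a ∷ v) + lincomb (bracket a b) (λ y → F (u ++ y ∷ v))

  respectsBracket-cong : ∀ {F G} → (∀ w → F w ≈ G w) → RespectsBracket F → RespectsBracket G
  respectsBracket-cong {F} {G} F≈G resp u a b v = begin
    G (u ++ a ∷ b ∷ v)                                               ≈⟨ ≈-sym (F≈G _) ⟩
    F (u ++ a ∷ b ∷ v)                                               ≈⟨ resp u a b v ⟩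
    F (u ++ b ∷ a ∷ v) + lincomb (bracket a b) (λ y → F (u ++ y ∷ v)) ≈⟨ +-cong (F≈G _) (lincomb-cong (bracket a b) (λ y → F≈G _)) ⟩
    G (u ++ b ∷ a ∷ v) + lincomb (bracket a b) (λ y → G (u ++ y ∷ v)) ∎

  respectsBracket-+ : ∀ {F G} → RespectsBracket F → RespectsBracket G → RespectsBracket (λ w → F w + G w)
  respectsBracket-+ {F} {G} respF respG u a b v = begin
    F (u ++ a ∷ b ∷ v) + G (u ++ a ∷ b ∷ v) ≈⟨ +-cong (respF u a b v) (respG u a b v) ⟩
    (F (u ++ b ∷ a ∷ v) + lincomb (bracket a b) (λ y → F (u ++ y ∷ v))) +
    (G (u ++ b ∷ a ∷ v) + lincomb (bracket a b) (λ y → G (u ++ y ∷ v))) ≈⟨ +-interchange _ _ _ _ ⟩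
    (F (u ++ b ∷ a ∷ v) + G (u ++ b ∷ a ∷ v)) +
    (lincomb (bracket a b) (λ y → F (u ++ y ∷ v)) + lincomb (bracket a b) (λ y → G (u ++ y ∷ v)))
      ≈⟨ +-congˡ (≈-sym (lincomb-+ (bracket a b) _ _)) ⟩
    (F (u ++ b ∷ a ∷ v) + G (u ++ b ∷ a ∷ v)) + lincomb (bracket a b) (λ y → F (u ++ y ∷ v) + G (u ++ y ∷ v)) ∎

  respectsBracket-shift : ∀ {F} x → RespectsBracket F → RespectsBracket (shift x F)
  respectsBracket-shift x resp u = resp (x ∷ u)

  respectsBracket-prefix : ∀ {F} p → RespectsBracket F → RespectsBracket (λ w → F (p ++ w))
  respectsBracket-prefix {F} p resp u a b v
    rewrite ≡.sym (Listₚ.++-assoc p u (a ∷ b ∷ v)) | ≡.sym (Listₚ.++-assoc p u (b ∷ a ∷ v)) =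
    ≈-trans (resp (p ++ u) a b v)
            (+-congˡ (lincomb-cong (bracket a b) (λ y → ≡⇒≈ (≡.cong F (Listₚ.++-assoc p u (y ∷ v))))))

  respectsBracket-null : ∀ {F} → (∀ x w → F (x ∷ w) ≈ 0#) → RespectsBracket F
  respectsBracket-null {F} null u a b v = begin
    F (u ++ a ∷ b ∷ v)  ≈⟨ null-after u ⟩
    0#                  ≈⟨ ≈-sym (+-identityʳ 0#) ⟩
    0# + 0#             ≈⟨ ≈-sym (+-cong (null-after u) (lincomb-zero (bracket a b) (λ y → null-after u))) ⟩
    F (u ++ b ∷ a ∷ v) + lincomb (bracket a b) (λ y → F (u ++ y ∷ v)) ∎
    where
    null-after : ∀ u {x w} → F (u ++ x ∷ w) ≈ 0#
    null-after []      = null _ _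
    null-after (z ∷ u) = null _ _

  -- leibniz F G w is the value of w on the product of the two elements whose families are F and G
  leibniz : Family → Family → Family
  leibniz F G []      = F [] * G []
  leibniz F G (x ∷ r) = leibniz (shift x F) G r + leibniz F (shift x G) r

  leibniz-cong : ∀ {F F′ G G′} → (∀ w → F w ≈ F′ w) → (∀ w → G w ≈ G′ w) → ∀ r → leibniz F G r ≈ leibniz F′ G′ r
  leibniz-cong hF hG []      = *-cong (hF []) (hG [])
  leibniz-cong hF hG (x ∷ r) = +-cong (leibniz-cong (hF ∘ (x ∷_)) hG r) (leibniz-cong hF (hG ∘ (x ∷_)) r)

  leibniz-+ˡ : ∀ F F′ G r → leibniz (λ w → F w + F′ w) G r ≈ leibniz F G r + leibniz F′ G r
  leibniz-+ˡ F F′ G []      = distribʳ (G []) (F []) (F′ [])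
  leibniz-+ˡ F F′ G (x ∷ r) = ≈-trans (+-cong (leibniz-+ˡ _ _ G r) (leibniz-+ˡ F F′ _ r)) (+-interchange _ _ _ _)

  leibniz-+ʳ : ∀ F G G′ r → leibniz F (λ w → G w + G′ w) r ≈ leibniz F G r + leibniz F G′ r
  leibniz-+ʳ F G G′ []      = distribˡ (F []) (G []) (G′ [])
  leibniz-+ʳ F G G′ (x ∷ r) = ≈-trans (+-cong (leibniz-+ʳ _ G G′ r) (leibniz-+ʳ F _ _ r)) (+-interchange _ _ _ _)

  leibniz-*ˡ : ∀ a F G r → leibniz (λ w → a * F w) G r ≈ a * leibniz F G r
  leibniz-*ˡ a F G []      = *-assoc a (F []) (G [])
  leibniz-*ˡ a F G (x ∷ r) = ≈-trans (+-cong (leibniz-*ˡ a _ G r) (leibniz-*ˡ a F _ r)) (≈-sym (distribˡ a _ _))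

  leibniz-*ʳ : ∀ a F G r → leibniz F (λ w → a * G w) r ≈ a * leibniz F G r
  leibniz-*ʳ a F G []      = *-left-comm (F []) a (G [])
  leibniz-*ʳ a F G (x ∷ r) = ≈-trans (+-cong (leibniz-*ʳ a _ G r) (leibniz-*ʳ a F _ r)) (≈-sym (distribˡ a _ _))

  leibniz-zeroˡ : ∀ G r → leibniz (λ _ → 0#) G r ≈ 0#
  leibniz-zeroˡ G []      = zeroˡ (G [])
  leibniz-zeroˡ G (x ∷ r) = ≈-trans (+-cong (leibniz-zeroˡ G r) (leibniz-zeroˡ _ r)) (+-identityʳ 0#)

  leibniz-zeroʳ : ∀ F r → leibniz F (λ _ → 0#) r ≈ 0#
  leibniz-zeroʳ F []      = zeroʳ (F [])
  leibniz-zeroʳ F (x ∷ r) = ≈-trans (+-cong (leibniz-zeroʳ _ r) (leibniz-zeroʳ F r)) (+-identityʳ 0#)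

  leibniz-lincombˡ : {A : Set} (xs : Comb A) (Φ : A → Family) (G : Family) (r : Word) →
                     leibniz (λ w → lincomb xs (λ y → Φ y w)) G r ≈ lincomb xs (λ y → leibniz (Φ y) G r)
  leibniz-lincombˡ []             Φ G r = leibniz-zeroˡ G r
  leibniz-lincombˡ ((α , a) ∷ xs) Φ G r =
    ≈-trans (leibniz-+ˡ _ _ G r) (+-cong (leibniz-*ˡ α (Φ a) G r) (leibniz-lincombˡ xs Φ G r))

  leibniz-lincombʳ : {A : Set} (xs : Comb A) (F : Family) (Φ : A → Family) (r : Word) →
                     leibniz F (λ w → lincomb xs (λ y → Φ y w)) r ≈ lincomb xs (λ y → leibniz F (Φ y) r)
  leibniz-lincombʳ []             F Φ r = leibniz-zeroʳ F r
  leibniz-lincombʳ ((α , a) ∷ xs) F Φ r =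
    ≈-trans (leibniz-+ʳ F _ _ r) (+-cong (leibniz-*ʳ α F (Φ a) r) (leibniz-lincombʳ xs F Φ r))

  leibniz-null : ∀ F G → (∀ x w → F (x ∷ w) ≈ 0#) → ∀ r → leibniz F G r ≈ F [] * G r
  leibniz-null F G null []      = ≈-refl
  leibniz-null F G null (x ∷ r) = begin
    leibniz (shift x F) G r + leibniz F (shift x G) r
      ≈⟨ +-cong (leibniz-null _ G (λ y w → null x (y ∷ w)) r) (leibniz-null F _ null r) ⟩
    F (x ∷ []) * G r + F [] * G (x ∷ r) ≈⟨ +-congʳ (≈-trans (*-congʳ (null x [])) (zeroˡ _)) ⟩
    0# + F [] * G (x ∷ r)               ≈⟨ +-identityˡ _ ⟩
    F [] * G (x ∷ r)                    ∎

  respectsBracket-leibniz : ∀ {F G} → RespectsBracket F → RespectsBracket G → RespectsBracket (leibniz F G)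
  respectsBracket-leibniz {F} {G} respF respG (x ∷ u) a b v = begin
    leibniz (shift x F) G (u ++ a ∷ b ∷ v) + leibniz F (shift x G) (u ++ a ∷ b ∷ v)
      ≈⟨ +-cong (respectsBracket-leibniz {shift x F} {G} (respectsBracket-shift {F} x respF) respG u a b v)
                (respectsBracket-leibniz {F} {shift x G} respF (respectsBracket-shift {G} x respG) u a b v) ⟩
    (leibniz (shift x F) G (u ++ b ∷ a ∷ v) + lincomb (bracket a b) (λ y → leibniz (shift x F) G (u ++ y ∷ v))) +
    (leibniz F (shift x G) (u ++ b ∷ a ∷ v) + lincomb (bracket a b) (λ y → leibniz F (shift x G) (u ++ y ∷ v)))
      ≈⟨ +-interchange _ _ _ _ ⟩
    _ + (lincomb (bracket a b) (λ y → leibniz (shift x F) G (u ++ y ∷ v)) + lincomb (bracket a b) (λ y → leibniz F (shift x G) (u ++ y ∷ v)))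
      ≈⟨ +-congˡ (≈-sym (lincomb-+ (bracket a b) _ _)) ⟩
    _ ∎
  respectsBracket-leibniz {F} {G} respF respG [] a b v = begin
    (leibniz Fab G v + leibniz Fa Gb v) + (leibniz Fb Ga v + leibniz F Gab v)
      ≈⟨ +-cong (+-congʳ (leibniz-cong (respF [] a b) (λ _ → ≈-refl) v))
                (+-congˡ (leibniz-cong (λ _ → ≈-refl) (respG [] a b) v)) ⟩
    (leibniz (λ w → Fba w + [F] w) G v + leibniz Fa Gb v) + (leibniz Fb Ga v + leibniz F (λ w → Gba w + [G] w) v)
      ≈⟨ +-cong (+-congʳ (leibniz-+ˡ Fba [F] G v)) (+-congˡ (leibniz-+ʳ F Gba [G] v)) ⟩
    ((leibniz Fba G v + leibniz [F] G v) + leibniz Fa Gb v) + (leibniz Fb Ga v + (leibniz F Gba v + leibniz F [G] v))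
      ≈⟨ solve 6 (λ p q r s t u → (((p ⊞ q) ⊞ r) ⊞ (s ⊞ (t ⊞ u))) ⊜ (((p ⊞ s) ⊞ (r ⊞ t)) ⊞ (q ⊞ u))) ≈-refl _ _ _ _ _ _ ⟩
    ((leibniz Fba G v + leibniz Fb Ga v) + (leibniz Fa Gb v + leibniz F Gba v)) + (leibniz [F] G v + leibniz F [G] v)
      ≈⟨ +-congˡ (+-cong (leibniz-lincombˡ (bracket a b) (λ y → shift y F) G v) (leibniz-lincombʳ (bracket a b) F (λ y → shift y G) v)) ⟩
    _ + (lincomb (bracket a b) (λ y → leibniz (shift y F) G v) + lincomb (bracket a b) (λ y → leibniz F (shift y G) v))
      ≈⟨ +-congˡ (≈-sym (lincomb-+ (bracket a b) _ _)) ⟩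
    _ ∎
    where
    Fa = shift a F
    Fb = shift b F
    Ga = shift a G
    Gb = shift b G
    Fab = λ w → F (a ∷ b ∷ w)
    Fba = λ w → F (b ∷ a ∷ w)
    Gab = λ w → G (a ∷ b ∷ w)
    Gba = λ w → G (b ∷ a ∷ w)
    [F] = λ w → lincomb (bracket a b) (λ y → F (y ∷ w))
    [G] = λ w → lincomb (bracket a b) (λ y → G (y ∷ w))

  commutatorTerms : X → X → ℕ → Word → Comb Word
  commutatorTerms x l zero    w = []
  commutatorTerms x l (suc n) w =
    mapKeys (λ y → y ∷ List.replicate n l ++ w) (bracket x l) ++ mapKeys (l ∷_) (commutatorTerms x l n w)

  move-past-power : ∀ {F} → RespectsBracket F → ∀ x l n w →
                    F (x ∷ List.replicate n l ++ w) ≈ F (List.replicate n l ++ x ∷ w) + lincomb (commutatorTerms x l n w) F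
  move-past-power resp x l zero    w = ≈-sym (+-identityʳ _)
  move-past-power {F} resp x l (suc n) w = begin
    F (x ∷ l ∷ lⁿ ++ w)
      ≈⟨ resp [] x l (lⁿ ++ w) ⟩
    F (l ∷ x ∷ lⁿ ++ w) + lincomb (bracket x l) (λ y → F (y ∷ lⁿ ++ w))
      ≈⟨ +-congʳ (move-past-power {shift l F} (respectsBracket-shift {F} l resp) x l n w) ⟩
    (F (l ∷ lⁿ ++ x ∷ w) + lincomb (commutatorTerms x l n w) (shift l F)) + lincomb (bracket x l) (λ y → F (y ∷ lⁿ ++ w))
      ≈⟨ +-assoc _ _ _ ⟩
    F (l ∷ lⁿ ++ x ∷ w) + (lincomb (commutatorTerms x l n w) (shift l F) + lincomb (bracket x l) (λ y → F (y ∷ lⁿ ++ w)))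
      ≈⟨ +-congˡ (≈-trans (+-comm _ _) (+-cong (≡⇒≈ (≡.sym (lincomb-mapKeys _ (bracket x l) F)))
                                              (≡⇒≈ (≡.sym (lincomb-mapKeys _ (commutatorTerms x l n w) F))))) ⟩
    F (l ∷ lⁿ ++ x ∷ w) + (lincomb (mapKeys (λ y → y ∷ lⁿ ++ w) (bracket x l)) F + lincomb (mapKeys (l ∷_) (commutatorTerms x l n w)) F)
      ≈⟨ +-congˡ (≈-sym (lincomb-++ (mapKeys (λ y → y ∷ lⁿ ++ w) (bracket x l)) (mapKeys (l ∷_) (commutatorTerms x l n w)) F)) ⟩
    F (l ∷ lⁿ ++ x ∷ w) + lincomb (commutatorTerms x l (suc n) w) F ∎
    where lⁿ = List.replicate n l

  length-replicate-++ : ∀ n (l : X) w → List.length (List.replicate n l ++ w) ≡ n ℕ.+ List.length w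
  length-replicate-++ n l w = ≡.trans (Listₚ.length-++ (List.replicate n l)) (≡.cong (ℕ._+ List.length w) (Listₚ.length-replicate n))

  commutatorTerms-length : ∀ x l n w → AllKeys (λ u → List.length u ℕ.≤ n ℕ.+ List.length w) (commutatorTerms x l n w)
  commutatorTerms-length x l zero    w = []
  commutatorTerms-length x l (suc n) w =
    Allₚ.++⁺ (Allₚ.map⁺ (All.universal (λ _ → s≤s (ℕₚ.≤-reflexive (length-replicate-++ n l w))) (bracket x l)))
             (AllKeys-mapKeys _ s≤s (commutatorTerms-length x l n w))

  monomial : ∀ {m} → Vec X m → Vec ℕ m → Word
  monomial []            []       = []
  monomial (l ∷ order) (e ∷ es) = List.replicate e l ++ monomial order es

  length-monomial : ∀ {m} (order : Vec X m) es → List.length (monomial order es) ≡ Vec.sum es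
  length-monomial []          []       = refl
  length-monomial (l ∷ order) (e ∷ es) =
    ≡.trans (length-replicate-++ e l (monomial order es)) (≡.cong (e ℕ.+_) (length-monomial order es))

  monomial-zeros : ∀ {m} (order : Vec X m) → monomial order (Vec.replicate m 0) ≡ []
  monomial-zeros []          = refl
  monomial-zeros (l ∷ order) = monomial-zeros order

  insertionTerms : ∀ {m} → Vec X m → Fin m → Vec ℕ m → Comb Word
  insertionTerms (l ∷ order) Fin.zero    (e ∷ es) = []
  insertionTerms (l ∷ order) (Fin.suc p) (e ∷ es) =
    commutatorTerms (lookup order p) l e (monomial order es) ++ mapKeys (List.replicate e l ++_) (insertionTerms order p es)

  insert-into-monomial : ∀ {m} (order : Vec X m) p es {F} → RespectsBracket F →
    F (lookup order p ∷ monomial order es) ≈ F (monomial order (updateAt es p suc)) + lincomb (insertionTerms order p es) F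
  insert-into-monomial (l ∷ order) Fin.zero    (e ∷ es) resp = ≈-sym (+-identityʳ _)
  insert-into-monomial (l ∷ order) (Fin.suc p) (e ∷ es) {F} resp = begin
    F (x ∷ lᵉ ++ monomial order es)
      ≈⟨ move-past-power resp x l e _ ⟩
    F (lᵉ ++ x ∷ monomial order es) + lincomb C F
      ≈⟨ +-congʳ (insert-into-monomial order p es {λ u → F (lᵉ ++ u)} (respectsBracket-prefix {F} lᵉ resp)) ⟩
    (F (lᵉ ++ monomial order (updateAt es p suc)) + lincomb I (λ u → F (lᵉ ++ u))) + lincomb C F
      ≈⟨ +-assoc _ _ _ ⟩
    F (lᵉ ++ monomial order (updateAt es p suc)) + (lincomb I (λ u → F (lᵉ ++ u)) + lincomb C F)
      ≈⟨ +-congˡ (≈-trans (+-comm _ _) (≈-trans (+-congˡ (≡⇒≈ (≡.sym (lincomb-mapKeys (lᵉ ++_) I F))))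
                                                (≈-sym (lincomb-++ C (mapKeys (lᵉ ++_) I) F)))) ⟩
    F (lᵉ ++ monomial order (updateAt es p suc)) + lincomb (insertionTerms (l ∷ order) (Fin.suc p) (e ∷ es)) F ∎
    where
    x  = lookup order p
    lᵉ = List.replicate e l
    C  = commutatorTerms x l e (monomial order es)
    I  = insertionTerms order p es

  insertionTerms-length : ∀ {m} (order : Vec X m) p es → AllKeys (λ u → List.length u ℕ.≤ Vec.sum es) (insertionTerms order p es)
  insertionTerms-length (l ∷ order) Fin.zero    (e ∷ es) = []
  insertionTerms-length (l ∷ order) (Fin.suc p) (e ∷ es) =
    Allₚ.++⁺ (All.map (λ h → ℕₚ.≤-trans h (ℕₚ.≤-reflexive (≡.cong (e ℕ.+_) (length-monomial order es))))
                      (commutatorTerms-length (lookup order p) l e (monomial order es)))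
             (AllKeys-mapKeys _ (λ {u} h → ℕₚ.≤-trans (ℕₚ.≤-reflexive (length-replicate-++ e l u)) (ℕₚ.+-monoʳ-≤ e h))
                              (insertionTerms-length order p es))

  module Straightening {m : ℕ} (order : Vec X m) (position : X → Fin m)
                       (lookup-position : ∀ x → lookup order (position x) ≡ x) where

    zeros : Vec ℕ m
    zeros = Vec.replicate m 0

    -- the fuel n bounds |w|: insertion terms are strictly shorter than the word being straightened
    straighten : ℕ → Word → Comb (Vec ℕ m)
    straighten _       []      = (1# , zeros) ∷ []
    straighten zero    (_ ∷ _) = []
    straighten (suc n) (x ∷ w) = substitute (straighten n w) (λ e →
      (1# , updateAt e (position x) suc) ∷ substitute (insertionTerms order (position x) e) (straighten n))

    straighten-degree : ∀ n w → List.length w ℕ.≤ n → AllKeys (λ e → Vec.sum e ℕ.≤ List.length w) (straighten n w)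
    straighten-degree n       []      h = ℕₚ.≤-reflexive (sum-replicate-0 m) ∷ []
    straighten-degree (suc n) (x ∷ w) (s≤s h) =
      AllKeys-substitute _ (straighten-degree n w h) (λ e e≤w →
        ℕₚ.≤-trans (ℕₚ.≤-reflexive (sum-updateAt-suc e (position x))) (s≤s e≤w) ∷
        AllKeys-substitute _ (insertionTerms-length order (position x) e) (λ u u≤e →
          All.map (λ h′ → ℕₚ.≤-trans h′ (ℕₚ.≤-trans u≤e (ℕₚ.≤-trans e≤w (ℕₚ.n≤1+n _))))
                  (straighten-degree n u (ℕₚ.≤-trans u≤e (ℕₚ.≤-trans e≤w h)))))

    straighten-correct : ∀ n w → List.length w ℕ.≤ n → ∀ {F} → RespectsBracket F →
                         F w ≈ lincomb (straighten n w) (F ∘ monomial order)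
    straighten-correct n [] h {F} resp =
      ≈-sym (≈-trans (+-identityʳ _) (≈-trans (*-identityˡ _) (≡⇒≈ (≡.cong F (monomial-zeros order)))))
    straighten-correct (suc n) (x ∷ w) (s≤s h) {F} resp = begin
      F (x ∷ w)
        ≈⟨ straighten-correct n w h {shift x F} (respectsBracket-shift {F} x resp) ⟩
      lincomb (straighten n w) (λ e → F (x ∷ monomial order e))
        ≈⟨ lincomb-congᴬ (straighten-degree n w h) insert ⟩
      lincomb (straighten n w) (λ e → lincomb (next e) (F ∘ monomial order))
        ≈⟨ ≈-sym (lincomb-substitute (straighten n w) _ _) ⟩
      lincomb (straighten (suc n) (x ∷ w)) (F ∘ monomial order) ∎
      where
      p = position x
      next : Vec ℕ m → Comb (Vec ℕ m)
      next e = (1# , updateAt e p suc) ∷ substitute (insertionTerms order p e) (straighten n)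
      insert : ∀ e → Vec.sum e ℕ.≤ List.length w → F (x ∷ monomial order e) ≈ lincomb (next e) (F ∘ monomial order)
      insert e e≤w = begin
        F (x ∷ monomial order e)
          ≈⟨ ≡⇒≈ (≡.cong (λ z → F (z ∷ monomial order e)) (≡.sym (lookup-position x))) ⟩
        F (lookup order p ∷ monomial order e)
          ≈⟨ insert-into-monomial order p e resp ⟩
        F (monomial order (updateAt e p suc)) + lincomb (insertionTerms order p e) F
          ≈⟨ +-cong (≈-sym (*-identityˡ _)) (lincomb-congᴬ (insertionTerms-length order p e)
                      (λ u u≤e → straighten-correct n u (ℕₚ.≤-trans u≤e (ℕₚ.≤-trans e≤w h)) resp)) ⟩
        1# * F (monomial order (updateAt e p suc)) + lincomb (insertionTerms order p e) (λ u → lincomb (straighten n u) (F ∘ monomial order))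
          ≈⟨ +-congˡ (≈-sym (lincomb-substitute (insertionTerms order p e) (straighten n) _)) ⟩
        lincomb (next e) (F ∘ monomial order) ∎

  leibniz-power : ∀ n l w F G → leibniz F G (List.replicate n l ++ w) ≈
                  lincomb (binomialExpansion n) (λ ij → leibniz (λ u → F (List.replicate (proj₁ ij) l ++ u))
                                                                (λ u → G (List.replicate (proj₂ ij) l ++ u)) w)
  leibniz-power zero    l w F G = ≈-sym (≈-trans (+-identityʳ _) (*-identityˡ _))
  leibniz-power (suc n) l w F G = begin
    leibniz (shift l F) G (lⁿ ++ w) + leibniz F (shift l G) (lⁿ ++ w)
      ≈⟨ +-cong (leibniz-power n l w _ G) (leibniz-power n l w F _) ⟩
    lincomb (binomialExpansion n) (Φ ∘ Product.map₁ suc) + lincomb (binomialExpansion n) (Φ ∘ Product.map₂ suc)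
      ≈⟨ ≈-sym (+-cong (≡⇒≈ (lincomb-mapKeys _ (binomialExpansion n) Φ)) (≡⇒≈ (lincomb-mapKeys _ (binomialExpansion n) Φ))) ⟩
    lincomb (mapKeys (Product.map₁ suc) (binomialExpansion n)) Φ + lincomb (mapKeys (Product.map₂ suc) (binomialExpansion n)) Φ
      ≈⟨ ≈-sym (lincomb-++ (mapKeys (Product.map₁ suc) (binomialExpansion n)) _ Φ) ⟩
    lincomb (binomialExpansion (suc n)) Φ ∎
    where
    lⁿ = List.replicate n l
    Φ : ℕ × ℕ → Carrier
    Φ ij = leibniz (λ u → F (List.replicate (proj₁ ij) l ++ u)) (λ u → G (List.replicate (proj₂ ij) l ++ u)) w

  leibniz-monomial : ∀ {m} (order : Vec X m) es F G →
                     leibniz F G (monomial order es) ≈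
                     lincomb (leibnizTerms es) (λ βγ → F (monomial order (proj₁ βγ)) * G (monomial order (proj₂ βγ)))
  leibniz-monomial []          []       F G = ≈-sym (≈-trans (+-identityʳ _) (*-identityˡ _))
  leibniz-monomial (l ∷ order) (e ∷ es) F G = begin
    leibniz F G (List.replicate e l ++ monomial order es)
      ≈⟨ leibniz-power e l (monomial order es) F G ⟩
    lincomb (binomialExpansion e) (λ ij → leibniz (Fᵢ ij) (Gⱼ ij) (monomial order es))
      ≈⟨ ≈-sym (lincomb-binomialTerms e _) ⟩
    lincomb (binomialTerms e) (λ ij → leibniz (Fᵢ ij) (Gⱼ ij) (monomial order es))
      ≈⟨ lincomb-cong (binomialTerms e) (λ ij → ≈-trans (leibniz-monomial order es _ _)
                                                 (≡⇒≈ (≡.sym (lincomb-mapKeys _ (leibnizTerms es) Ψ)))) ⟩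
    lincomb (binomialTerms e) (λ ij → lincomb (mapKeys (Product.zip _∷_ _∷_ ij) (leibnizTerms es)) Ψ)
      ≈⟨ ≈-sym (lincomb-substitute (binomialTerms e) _ Ψ) ⟩
    lincomb (leibnizTerms (e ∷ es)) Ψ ∎
    where
    Fᵢ Gⱼ : ℕ × ℕ → Family
    Fᵢ ij u = F (List.replicate (proj₁ ij) l ++ u)
    Gⱼ ij u = G (List.replicate (proj₂ ij) l ++ u)
    Ψ : Vec ℕ _ × Vec ℕ _ → Carrier
    Ψ βγ = F (monomial (l ∷ order) (proj₁ βγ)) * G (monomial (l ∷ order) (proj₂ βγ))

module GlFamilies (R : CommutativeRing 0ℓ 0ℓ) (k d : ℕ) where
  open CommutativeRing R renaming (refl to ≈-refl; sym to ≈-sym; trans to ≈-trans)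
  open import Relation.Binary.Reasoning.Setoid setoid
  open Meta R k d hiding (Word)
  open Combinations R
  open CoefficientAction R
  open WordFamilies R (glBracket {k}) public

  -- the first letter is applied first: (E_{x₁} ⋯ E_{x_ℓ}).Δ = applyWord (x_ℓ ∷ ⋯ ∷ x₁) Δ
  applyWord : Word → MetaPoly → MetaPoly
  applyWord []            e = e
  applyWord ((i , j) ∷ r) e = applyWord r (elemAct i j e)

  applyWord-⊕ : ∀ r e f → applyWord r (e ⊕ f) ≡ applyWord r e ⊕ applyWord r f
  applyWord-⊕ []            e f = refl
  applyWord-⊕ ((i , j) ∷ r) e f = applyWord-⊕ r (elemAct i j e) (elemAct i j f)

  applyWord-++ : ∀ u v e → applyWord (u ++ v) e ≡ applyWord v (applyWord u e)
  applyWord-++ []            v e = refl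
  applyWord-++ ((i , j) ∷ u) v e = applyWord-++ u v (elemAct i j e)

  wordAct-applyWord : ∀ w e → wordAct w e ≡ applyWord (List.reverse w) e
  wordAct-applyWord []            e = refl
  wordAct-applyWord ((i , j) ∷ w) e = ≡.trans (≡.cong (elemAct i j) (wordAct-applyWord w e))
    (≡.trans (≡.sym (applyWord-++ (List.reverse w) ((i , j) ∷ []) e))
             (≡.cong (λ z → applyWord z e) (≡.sym (Listₚ.unfold-reverse (i , j) w))))

  module Evaluated (c : Mono k d → Carrier) where

    family : MetaPoly → Family
    family e r = eval c (applyWord r e)

    family-zero : ∀ r → family (con 0#) r ≈ 0#
    family-zero []            = ≈-refl
    family-zero ((i , j) ∷ r) = family-zero r

    family-con-null : ∀ a x w → family (con a) (x ∷ w) ≈ 0#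
    family-con-null a (i , j) w = family-zero w

    family-⊕ : ∀ e f r → family (e ⊕ f) r ≈ family e r + family f r
    family-⊕ e f r rewrite applyWord-⊕ r e f = ≈-refl

    family-⊗ : ∀ e f r → family (e ⊗ f) r ≈ leibniz (family e) (family f) r
    family-⊗ e f []            = ≈-refl
    family-⊗ e f ((i , j) ∷ r) =
      ≈-trans (family-⊕ _ _ r) (+-cong (family-⊗ _ _ r) (family-⊗ _ _ r))

    family-scalar : ∀ a e r → family (con a ⊗ e) r ≈ a * family e r
    family-scalar a e r = ≈-trans (family-⊗ (con a) e r) (leibniz-null (family (con a)) (family e) (family-con-null a) r)

    -- ν ↦ r.c_ν, extended by 0 off the exponents of degree d
    varFamily : Word → CoeffFun k
    varFamily r ν with Vec.sum ν ℕ.≟ d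
    ... | yes p = family (var (ν , p)) r
    ... | no  _ = 0#

    varFamily-yes : ∀ r ν (p : Vec.sum ν ≡ d) → varFamily r ν ≈ family (var (ν , p)) r
    varFamily-yes r ν p with Vec.sum ν ℕ.≟ d
    ... | yes p′ rewrite ℕₚ.≡-irrelevant p′ p = ≈-refl
    ... | no ¬p  = ⊥-elim (¬p p)

    varFamily-no : ∀ r ν → Vec.sum ν ≢ d → varFamily r ν ≈ 0#
    varFamily-no r ν ¬p with Vec.sum ν ℕ.≟ d
    ... | yes p = ⊥-elim (¬p p)
    ... | no  _ = ≈-refl

    glOp-varFamily-no : ∀ i j r ν → Vec.sum ν ≢ d → glOp (i , j) (varFamily r) ν ≈ 0#
    glOp-varFamily-no i j r ν ¬p with lookup ν j in eq
    ... | zero  = ≈-refl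
    ... | suc t = ≈-trans (*-congˡ (varFamily-no r (updateAt (updateAt ν j ℕ.pred) i suc) (¬p ∘ ≡.trans (≡.sym (sum-updateAt-suc-pred ν i j eq))))) (zeroʳ _)

    family-var-step : ∀ i j r ν p → family (var (ν , p)) ((i , j) ∷ r) ≈ glOp (i , j) (varFamily r) ν
    family-var-step i j r ν p with i Fin.≟ j
    family-var-step i .i r ν p | yes refl with lookup ν i in eq
    ... | zero  = ≈-trans (family-scalar (natCast R 0) (var (ν , p)) r) (zeroˡ _)
    ... | suc t rewrite Vecₚ.lookup∘updateAt i {ℕ.pred} ν | eq | updateAt-suc∘pred ν i eq =
          ≈-trans (family-scalar _ (var (ν , p)) r) (*-congˡ (≈-sym (varFamily-yes r ν p)))
    family-var-step i j r ν p | no i≢j with lookup ν j in eq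
    ... | zero  = family-zero r
    ... | suc t with updateAt (updateAt ν i suc) j ℕ.pred in eq₂
    ...   | μ with Vec.sum μ ℕ.≟ d
    ...     | yes q rewrite Vecₚ.lookup∘updateAt′ i j {ℕ.pred} i≢j ν | Vecₚ.updateAt-commutes i j {suc} {ℕ.pred} i≢j ν | eq₂ =
              ≈-trans (family-scalar _ _ r) (*-congˡ (≈-sym (varFamily-yes r μ q)))
    ...     | no ¬q rewrite Vecₚ.lookup∘updateAt′ i j {ℕ.pred} i≢j ν | Vecₚ.updateAt-commutes i j {suc} {ℕ.pred} i≢j ν | eq₂ =
              ≈-trans (family-zero r) (≈-sym (≈-trans (*-congˡ (varFamily-no r μ ¬q)) (zeroʳ _)))

    varFamily-step : ∀ x r ν → varFamily (x ∷ r) ν ≈ glOp x (varFamily r) ν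
    varFamily-step (i , j) r ν with Vec.sum ν ℕ.≟ d
    ... | no ¬p = ≈-sym (glOp-varFamily-no i j r ν ¬p)
    ... | yes p = family-var-step i j r ν p

    varFamily-respectsBracket : ∀ ν → RespectsBracket (λ w → varFamily w ν)
    varFamily-respectsBracket ν [] x y v = begin
      varFamily (x ∷ y ∷ v) ν                   ≈⟨ varFamily-step x _ ν ⟩
      glOp x (varFamily (y ∷ v)) ν              ≈⟨ IsLinearOp.cong (glOp-linear x) (varFamily-step y v) ν ⟩
      glOp x (glOp y (varFamily v)) ν           ≈⟨ glOp-commutator x y (varFamily v) ν ⟩
      glOp y (glOp x (varFamily v)) ν + lincomb (glBracket x y) (λ z → glOp z (varFamily v) ν)
        ≈⟨ +-cong (IsLinearOp.cong (glOp-linear y) (λ μ → ≈-sym (varFamily-step x v μ)) ν)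
                  (lincomb-cong (glBracket x y) (λ z → ≈-sym (varFamily-step z v ν))) ⟩
      glOp y (varFamily (x ∷ v)) ν + lincomb (glBracket x y) (λ z → varFamily (z ∷ v) ν)
        ≈⟨ +-congʳ (≈-sym (varFamily-step y _ ν)) ⟩
      varFamily (y ∷ x ∷ v) ν + lincomb (glBracket x y) (λ z → varFamily (z ∷ v) ν) ∎
    varFamily-respectsBracket ν (z ∷ u) x y v = begin
      varFamily (z ∷ u ++ x ∷ y ∷ v) ν
        ≈⟨ varFamily-step z _ ν ⟩
      glOp z (varFamily (u ++ x ∷ y ∷ v)) ν
        ≈⟨ IsLinearOp.cong (glOp-linear z) (λ μ → varFamily-respectsBracket μ u x y v) ν ⟩
      glOp z (λ μ → varFamily (u ++ y ∷ x ∷ v) μ + lincomb (glBracket x y) (λ t → varFamily (u ++ t ∷ v) μ)) ν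
        ≈⟨ IsLinearOp.+-homo (glOp-linear z) (varFamily (u ++ y ∷ x ∷ v)) (λ μ → lincomb (glBracket x y) (λ t → varFamily (u ++ t ∷ v) μ)) ν ⟩
      glOp z (varFamily (u ++ y ∷ x ∷ v)) ν + glOp z (λ μ → lincomb (glBracket x y) (λ t → varFamily (u ++ t ∷ v) μ)) ν
        ≈⟨ +-cong (≈-sym (varFamily-step z _ ν)) (linearOp-lincomb (glOp-linear z) (glBracket x y) (λ t → varFamily (u ++ t ∷ v)) ν) ⟩
      varFamily (z ∷ u ++ y ∷ x ∷ v) ν + lincomb (glBracket x y) (λ t → glOp z (varFamily (u ++ t ∷ v)) ν)
        ≈⟨ +-congˡ (lincomb-cong (glBracket x y) (λ t → ≈-sym (varFamily-step z _ ν))) ⟩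
      varFamily (z ∷ u ++ y ∷ x ∷ v) ν + lincomb (glBracket x y) (λ t → varFamily (z ∷ u ++ t ∷ v) ν) ∎

    family-respectsBracket : ∀ e → RespectsBracket (family e)
    family-respectsBracket (var (ν , p)) =
      respectsBracket-cong (λ w → varFamily-yes w ν p) (varFamily-respectsBracket ν)
    family-respectsBracket (con a) = respectsBracket-null {family (con a)} (family-con-null a)
    family-respectsBracket (e ⊕ f) = respectsBracket-cong (λ w → ≈-sym (family-⊕ e f w))
      (respectsBracket-+ {family e} {family f} (family-respectsBracket e) (family-respectsBracket f))
    family-respectsBracket (e ⊗ f) = respectsBracket-cong (λ w → ≈-sym (family-⊗ e f w))
      (respectsBracket-leibniz {family e} {family f} (family-respectsBracket e) (family-respectsBracket f))

module CircuitExtensions (R : CommutativeRing 0ℓ 0ℓ) (k d : ℕ) where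
  open CommutativeRing R renaming (refl to ≈-refl; sym to ≈-sym; trans to ≈-trans)
  open import Relation.Binary.Reasoning.Setoid setoid
  open Meta R k d
  open Combinations R

  Env : Set
  Env = Mono k d → Carrier

  gateValue : ∀ {n} → Circuit n → Fin n → Env → Carrier
  gateValue C x c = eval c (lookup (values C) x)

  record _⊑_ {n n′} (C : Circuit n) (C′ : Circuit n′) : Set where
    field
      embed        : Fin n → Fin n′
      embed-values : ∀ x → lookup (values C′) (embed x) ≡ lookup (values C) x
  open _⊑_ public

  ⊑-refl : ∀ {n} {C : Circuit n} → C ⊑ C
  ⊑-refl = record { embed = λ x → x ; embed-values = λ x → refl }

  ⊑-trans : ∀ {n₁ n₂ n₃} {C₁ : Circuit n₁} {C₂ : Circuit n₂} {C₃ : Circuit n₃} → C₁ ⊑ C₂ → C₂ ⊑ C₃ → C₁ ⊑ C₃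
  ⊑-trans e₁ e₂ = record
    { embed        = embed e₂ ∘ embed e₁
    ; embed-values = λ x → ≡.trans (embed-values e₂ (embed e₁ x)) (embed-values e₁ x)
    }

  ⊑-▷ : ∀ {n} {C : Circuit n} (g : Gate n) → C ⊑ (C ▷ g)
  ⊑-▷ g = record { embed = Fin.suc ; embed-values = λ x → refl }

  gateValue-embed : ∀ {n n′} {C : Circuit n} {C′ : Circuit n′} (e : C ⊑ C′) x c → gateValue C′ (embed e x) c ≈ gateValue C x c
  gateValue-embed e x c = ≡⇒≈ (≡.cong (eval c) (embed-values e x))

  record Extension {n} (C : Circuit n) (t : ℕ) (target : Env → Carrier) : Set where
    field
      {size}  : ℕ
      circuit : Circuit (suc size)
      extends : C ⊑ circuit
      output-correct : ∀ c → gateValue circuit Fin.zero c ≈ target c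
      size-≤  : suc size ℕ.≤ t ℕ.+ n

  extension-≤ : ∀ {n} {C : Circuit n} {target t t′} → t ℕ.≤ t′ → Extension C t target → Extension C t′ target
  extension-≤ t≤t′ ext = record
    { circuit = circuit ; extends = extends ; output-correct = output-correct
    ; size-≤ = ℕₚ.≤-trans size-≤ (ℕₚ.+-monoˡ-≤ _ t≤t′) }
    where open Extension ext

  extension-cong : ∀ {n} {C : Circuit n} {target target′ t} → (∀ c → target c ≈ target′ c) →
                   Extension C t target → Extension C t target′
  extension-cong t≈t′ ext = record
    { circuit = circuit ; extends = extends ; output-correct = λ c → ≈-trans (output-correct c) (t≈t′ c) ; size-≤ = size-≤ }
    where open Extension ext

  leafGate : ∀ {n} → Carrier → Gate n
  leafGate a = leaf a []

  linearCombination : ∀ {n} (C : Circuit n) (ts : Comb (Fin n)) →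
                      Extension C (suc (List.length ts)) (λ c → lincomb ts (λ x → gateValue C x c))
  linearCombination {n} C [] =
    record { circuit = C ▷ leafGate 0# ; extends = ⊑-▷ _ ; output-correct = λ c → ≈-refl ; size-≤ = ℕₚ.≤-refl }
  linearCombination {n} C ((γ , x) ∷ ts) = record
    { circuit = C′ ▷ add 1# Fin.zero γ (embed e x)
    ; extends = ⊑-trans e (⊑-▷ _)
    ; output-correct = λ c → ≈-trans (+-cong (*-identityˡ _) (*-congˡ (gateValue-embed e x c)))
                                     (≈-trans (+-congʳ (output-correct c)) (+-comm _ _))
    ; size-≤ = s≤s size-≤
    }
    where open Extension (linearCombination C ts) renaming (circuit to C′; extends to e)

  sumOfProducts : ∀ {n} (C : Circuit n) (ts : Comb (Fin n × Fin n)) →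
                  Extension C (suc (2 ℕ.* List.length ts)) (λ c → lincomb ts (λ xy → gateValue C (proj₁ xy) c * gateValue C (proj₂ xy) c))
  sumOfProducts {n} C [] =
    record { circuit = C ▷ leafGate 0# ; extends = ⊑-▷ _ ; output-correct = λ c → ≈-refl ; size-≤ = ℕₚ.≤-refl }
  sumOfProducts {n} C ((γ , (x , y)) ∷ ts) = record
    { circuit = C₂ ▷ add 1# (Fin.suc Fin.zero) 1# Fin.zero
    ; extends = ⊑-trans e (⊑-trans (⊑-▷ _) (⊑-▷ _))
    ; output-correct = correct
    ; size-≤ = ℕₚ.≤-trans (s≤s (s≤s size-≤)) (ℕₚ.≤-reflexive (count (List.length ts) n))
    }
    where
    open Extension (sumOfProducts C ts) renaming (circuit to C₁; extends to e)
    C₂ = C₁ ▷ mul γ (embed e x) 1# (embed e y)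
    count : ∀ l n → suc (suc (suc (2 ℕ.* l) ℕ.+ n)) ≡ suc (2 ℕ.* suc l) ℕ.+ n
    count = solve-∀
    P : Env → Carrier
    P c = lincomb ts (λ xy → gateValue C (proj₁ xy) c * gateValue C (proj₂ xy) c)
    correct : ∀ c → 1# * gateValue C₁ Fin.zero c + 1# * (((γ * 1#) * gateValue C₁ (embed e x) c) * gateValue C₁ (embed e y) c)
                    ≈ γ * (gateValue C x c * gateValue C y c) + P c
    correct c = begin
      1# * gateValue C₁ Fin.zero c + 1# * (((γ * 1#) * gateValue C₁ (embed e x) c) * gateValue C₁ (embed e y) c)
        ≈⟨ +-cong (*-identityˡ _) (*-identityˡ _) ⟩
      gateValue C₁ Fin.zero c + ((γ * 1#) * gateValue C₁ (embed e x) c) * gateValue C₁ (embed e y) c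
        ≈⟨ +-cong (output-correct c) (*-cong (*-cong (*-identityʳ γ) (gateValue-embed e x c)) (gateValue-embed e y c)) ⟩
      P c + (γ * gateValue C x c) * gateValue C y c
        ≈⟨ ≈-trans (+-comm _ _) (+-congʳ (*-assoc _ _ _)) ⟩
      γ * (gateValue C x c * gateValue C y c) + P c ∎

  sumFin : (N : ℕ) → (Fin N → ℕ) → ℕ
  sumFin zero    f = 0
  sumFin (suc N) f = f Fin.zero ℕ.+ sumFin N (f ∘ Fin.suc)

  sumFin-lookup : {A : Set} (xs : List A) (f : A → ℕ) → sumFin (List.length xs) (f ∘ List.lookup xs) ≡ sumℕ xs f
  sumFin-lookup []       f = refl
  sumFin-lookup (x ∷ xs) f = ≡.cong (f x ℕ.+_) (sumFin-lookup xs f)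

  sumFin-cong : ∀ N {f g : Fin N → ℕ} → (∀ p → f p ≡ g p) → sumFin N f ≡ sumFin N g
  sumFin-cong zero    h = refl
  sumFin-cong (suc N) h = ≡.cong₂ ℕ._+_ (h Fin.zero) (sumFin-cong N (h ∘ Fin.suc))

  sumFin-mono : ∀ N {f g : Fin N → ℕ} → (∀ p → f p ℕ.≤ g p) → sumFin N f ℕ.≤ sumFin N g
  sumFin-mono zero    h = z≤n
  sumFin-mono (suc N) h = ℕₚ.+-mono-≤ (h Fin.zero) (sumFin-mono N (h ∘ Fin.suc))

  record Extensions {n} (C : Circuit n) (N : ℕ) (t : ℕ) (target : Fin N → Env → Carrier) : Set where
    field
      {size}  : ℕ
      circuit : Circuit size
      extends : C ⊑ circuit
      outputs : Fin N → Fin size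
      outputs-correct : ∀ p c → gateValue circuit (outputs p) c ≈ target p c
      size-≤  : size ℕ.≤ t ℕ.+ n

  extensions-≤ : ∀ {n} {C : Circuit n} {N target t t′} → t ℕ.≤ t′ → Extensions C N t target → Extensions C N t′ target
  extensions-≤ t≤t′ ext = record
    { circuit = circuit ; extends = extends ; outputs = outputs ; outputs-correct = outputs-correct
    ; size-≤ = ℕₚ.≤-trans size-≤ (ℕₚ.+-monoˡ-≤ _ t≤t′) }
    where open Extensions ext

  extendAll : ∀ {n₀} {C₀ : Circuit n₀} (N : ℕ) (target : Fin N → Env → Carrier) (ts : Fin N → ℕ) →
              (∀ {n} {C : Circuit n} → C₀ ⊑ C → (p : Fin N) → Extension C (ts p) (target p)) →
              ∀ {n} (C : Circuit n) → C₀ ⊑ C → Extensions C N (sumFin N ts) target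
  extendAll zero    target ts extend C e =
    record { circuit = C ; extends = ⊑-refl ; outputs = λ () ; outputs-correct = λ () ; size-≤ = ℕₚ.≤-refl }
  extendAll (suc N) target ts extend C e = record
    { circuit = Rest.circuit
    ; extends = ⊑-trans First.extends Rest.extends
    ; outputs = outputs
    ; outputs-correct = correct
    ; size-≤ = ℕₚ.≤-trans Rest.size-≤ (ℕₚ.≤-trans (ℕₚ.+-monoʳ-≤ (sumFin N (ts ∘ Fin.suc)) First.size-≤)
                 (ℕₚ.≤-reflexive (regroup (sumFin N (ts ∘ Fin.suc)) (ts Fin.zero) _)))
    }
    where
    module First = Extension (extend e Fin.zero)
    module Rest = Extensions (extendAll N (target ∘ Fin.suc) (ts ∘ Fin.suc) (λ e′ → extend e′ ∘ Fin.suc)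
                                        First.circuit (⊑-trans e First.extends))
    outputs : Fin (suc N) → Fin Rest.size
    outputs Fin.zero    = embed Rest.extends Fin.zero
    outputs (Fin.suc p) = Rest.outputs p
    correct : ∀ p c → gateValue Rest.circuit (outputs p) c ≈ target p c
    correct Fin.zero    c = ≈-trans (gateValue-embed Rest.extends Fin.zero c) (First.output-correct c)
    correct (Fin.suc p) c = Rest.outputs-correct p c
    regroup : ∀ a b c → a ℕ.+ (b ℕ.+ c) ≡ (b ℕ.+ a) ℕ.+ c
    regroup = solve-∀

module JetTranslation (R : CommutativeRing 0ℓ 0ℓ) (k d : ℕ) where
  open CommutativeRing R renaming (refl to ≈-refl; sym to ≈-sym; trans to ≈-trans)
  open import Relation.Binary.Reasoning.Setoid setoid
  open Meta R k d hiding (Word)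
  open Combinations R
  open GlFamilies R k d
  open CircuitExtensions R k d

  data IsAffine : MetaPoly → Set where
    var : ∀ μ → IsAffine (var μ)
    con : ∀ a → IsAffine (con a)
    _⊕_ : ∀ {e f} → IsAffine e → IsAffine f → IsAffine (e ⊕ f)
    _⊛_ : ∀ a {e} → IsAffine e → IsAffine (con a ⊗ e)

  isAffine-elemVar : ∀ i j μ → IsAffine (elemVar i j μ)
  isAffine-elemVar i j (μ , p) with i Fin.≟ j
  ... | yes _ = _ ⊛ var _
  ... | no  _ with lookup μ j
  ...   | zero  = con _
  ...   | suc _ with updateAt (updateAt μ i suc) j ℕ.pred
  ...     | μ′ with Vec.sum μ′ ℕ.≟ d
  ...       | yes _ = _ ⊛ var _
  ...       | no  _ = con _

  isAffine-elemAct : ∀ i j {e} → IsAffine e → IsAffine (elemAct i j e)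
  isAffine-elemAct i j (var μ)   = isAffine-elemVar i j μ
  isAffine-elemAct i j (con a)   = con 0#
  isAffine-elemAct i j (l ⊕ l′)  = isAffine-elemAct i j l ⊕ isAffine-elemAct i j l′
  isAffine-elemAct i j (a ⊛ l)   = (0# ⊛ l) ⊕ (a ⊛ isAffine-elemAct i j l)

  isAffine-applyWord : ∀ r {e} → IsAffine e → IsAffine (applyWord r e)
  isAffine-applyWord []            l = l
  isAffine-applyWord ((i , j) ∷ r) l = isAffine-applyWord r (isAffine-elemAct i j l)

  isAffine-affine : ∀ a₀ bs → IsAffine (affine a₀ bs)
  isAffine-affine a₀ []             = con a₀
  isAffine-affine a₀ ((b , μ) ∷ bs) = (b ⊛ var μ) ⊕ isAffine-affine a₀ bs

  eval-affine : ∀ c a₀ bs → eval c (affine a₀ bs) ≈ lincomb bs c + a₀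
  eval-affine c a₀ []             = ≈-sym (+-identityˡ a₀)
  eval-affine c a₀ ((b , μ) ∷ bs) = ≈-trans (+-congˡ (eval-affine c a₀ bs)) (≈-sym (+-assoc _ _ _))

  affineForm : ∀ {e} → IsAffine e → Carrier × Comb (Mono k d)
  affineForm (var μ)  = 0# , (1# , μ) ∷ []
  affineForm (con a)  = a , []
  affineForm (l ⊕ l′) = proj₁ (affineForm l) + proj₁ (affineForm l′) , proj₂ (affineForm l) ++ proj₂ (affineForm l′)
  affineForm (a ⊛ l)  = a * proj₁ (affineForm l) , scale a (proj₂ (affineForm l))

  eval-affineForm : ∀ c {e} (l : IsAffine e) → eval c (affine (proj₁ (affineForm l)) (proj₂ (affineForm l))) ≈ eval c e
  eval-affineForm c l = ≈-trans (eval-affine c (proj₁ (affineForm l)) (proj₂ (affineForm l))) (≈-sym (correct l))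
    where
    correct : ∀ {e} (l : IsAffine e) → eval c e ≈ lincomb (proj₂ (affineForm l)) c + proj₁ (affineForm l)
    correct (var μ)  = ≈-sym (≈-trans (+-identityʳ _) (≈-trans (+-identityʳ _) (*-identityˡ _)))
    correct (con a)  = ≈-sym (+-identityˡ a)
    correct (l ⊕ l′) = ≈-trans (+-cong (correct l) (correct l′))
      (≈-trans (+-interchange _ _ _ _) (+-congʳ (≈-sym (lincomb-++ (proj₂ (affineForm l)) _ c))))
    correct (a ⊛ l)  = ≈-trans (*-congˡ (correct l))
      (≈-trans (distribˡ a _ _) (+-congʳ (≈-sym (lincomb-scale a (proj₂ (affineForm l)) c))))

  applyComb : Comb Word → MetaPoly → MetaPoly
  applyComb []             e = con 0#
  applyComb ((α , r) ∷ xs) e = (con α ⊗ applyWord r e) ⊕ applyComb xs e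

  isAffine-applyComb : ∀ xs {e} → IsAffine e → IsAffine (applyComb xs e)
  isAffine-applyComb []             l = con 0#
  isAffine-applyComb ((α , r) ∷ xs) l = (α ⊛ isAffine-applyWord r l) ⊕ isAffine-applyComb xs l

  eval-applyComb : ∀ c xs e → eval c (applyComb xs e) ≈ lincomb xs (Evaluated.family c e)
  eval-applyComb c []             e = ≈-refl
  eval-applyComb c ((α , r) ∷ xs) e = +-congˡ (eval-applyComb c xs e)

  -- N functionals on word families, closed under the Leibniz rule
  record JetSystem : Set where
    field
      N : ℕ
      jet : Fin N → Comb Word
      rule : Fin N → Comb (Fin N × Fin N)
      jet-leibniz : ∀ p F G → lincomb (jet p) (leibniz F G) ≈
                              lincomb (rule p) (λ qr → lincomb (jet (proj₁ qr)) F * lincomb (jet (proj₂ qr)) G)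

  module Translate (J : JetSystem) where
    open JetSystem J
    open Evaluated using (family; family-⊕; family-⊗; family-scalar)

    jetValue : Env → Fin N → MetaPoly → Carrier
    jetValue c p e = lincomb (jet p) (family c e)

    costPerGate : ℕ
    costPerGate = sumFin N (λ p → suc (2 ℕ.* List.length (rule p)))

    record Translation {n} (C : Circuit n) : Set where
      field
        {size}  : ℕ
        circuit : Circuit size
        jetGate : Fin n → Fin N → Fin size
        jetGate-correct : ∀ x p c → gateValue circuit (jetGate x p) c ≈ jetValue c p (lookup (values C) x)
        size-≤  : size ℕ.≤ n ℕ.* costPerGate

    N≤costPerGate : sumFin N (λ _ → 1) ℕ.≤ costPerGate
    N≤costPerGate = sumFin-mono N (λ p → s≤s z≤n)

    leafJet : ∀ a₀ bs {n} (C : Circuit n) (p : Fin N) → Extension C 1 (λ c → jetValue c p (affine a₀ bs))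
    leafJet a₀ bs C p = record
      { circuit = C ▷ leaf (proj₁ form) (proj₂ form) ; extends = ⊑-▷ _ ; size-≤ = ℕₚ.≤-refl
      ; output-correct = λ c → ≈-trans (eval-affineForm c isAffine) (eval-applyComb c (jet p) (affine a₀ bs)) }
      where
      isAffine = isAffine-applyComb (jet p) (isAffine-affine a₀ bs)
      form = affineForm isAffine

    module _ {n} {C : Circuit n} (tr : Translation C) (α : Carrier) (x : Fin n) (β : Carrier) (y : Fin n) where
      open Translation tr
      private
        u = lookup (values C) x
        v = lookup (values C) y

      addJet : ∀ {n′} {C′ : Circuit n′} → circuit ⊑ C′ → (p : Fin N) → Extension C′ 1 (λ c → jetValue c p ((con α ⊗ u) ⊕ (con β ⊗ v)))
      addJet {C′ = C′} e p = record
        { circuit = C′ ▷ add α (embed e (jetGate x p)) β (embed e (jetGate y p)) ; extends = ⊑-▷ _ ; size-≤ = ℕₚ.≤-refl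
        ; output-correct = correct }
        where
        correct : ∀ c → α * gateValue C′ (embed e (jetGate x p)) c + β * gateValue C′ (embed e (jetGate y p)) c
                        ≈ jetValue c p ((con α ⊗ u) ⊕ (con β ⊗ v))
        correct c = begin
          α * gateValue C′ (embed e (jetGate x p)) c + β * gateValue C′ (embed e (jetGate y p)) c
            ≈⟨ +-cong (*-congˡ (≈-trans (gateValue-embed e _ c) (jetGate-correct x p c)))
                      (*-congˡ (≈-trans (gateValue-embed e _ c) (jetGate-correct y p c))) ⟩
          α * jetValue c p u + β * jetValue c p v
            ≈⟨ ≈-sym (≈-trans (lincomb-+ (jet p) _ _) (+-cong (lincomb-*ˡ (jet p) α _) (lincomb-*ˡ (jet p) β _))) ⟩
          lincomb (jet p) (λ r → α * family c u r + β * family c v r)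
            ≈⟨ lincomb-cong (jet p) (λ r → ≈-sym (≈-trans (family-⊕ c _ _ r) (+-cong (family-scalar c α u r) (family-scalar c β v r)))) ⟩
          jetValue c p ((con α ⊗ u) ⊕ (con β ⊗ v)) ∎

      mulJet : ∀ {n′} {C′ : Circuit n′} → circuit ⊑ C′ → (p : Fin N) →
               Extension C′ (suc (2 ℕ.* List.length (rule p))) (λ c → jetValue c p ((con (α * β) ⊗ u) ⊗ v))
      mulJet {n′} {C′} e p = extension-≤ (ℕₚ.≤-reflexive (≡.cong (λ z → suc (2 ℕ.* z)) length-terms))
                                         (extension-cong correct (sumOfProducts C′ terms))
        where
        pair : Fin N × Fin N → Fin n′ × Fin n′
        pair (q , r) = embed e (jetGate x q) , embed e (jetGate y r)
        terms = scale (α * β) (mapKeys pair (rule p))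
        length-terms : List.length terms ≡ List.length (rule p)
        length-terms = ≡.trans (Listₚ.length-map _ (mapKeys pair (rule p))) (Listₚ.length-map _ (rule p))
        correct : ∀ c → lincomb terms (λ xy → gateValue C′ (proj₁ xy) c * gateValue C′ (proj₂ xy) c)
                        ≈ jetValue c p ((con (α * β) ⊗ u) ⊗ v)
        correct c = begin
          lincomb terms (λ xy → gateValue C′ (proj₁ xy) c * gateValue C′ (proj₂ xy) c)
            ≈⟨ lincomb-scale (α * β) (mapKeys pair (rule p)) _ ⟩
          (α * β) * lincomb (mapKeys pair (rule p)) (λ xy → gateValue C′ (proj₁ xy) c * gateValue C′ (proj₂ xy) c)
            ≈⟨ *-congˡ (≡⇒≈ (lincomb-mapKeys pair (rule p) _)) ⟩
          (α * β) * lincomb (rule p) (λ qr → gateValue C′ (embed e (jetGate x (proj₁ qr))) c * gateValue C′ (embed e (jetGate y (proj₂ qr))) c)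
            ≈⟨ *-congˡ (lincomb-cong (rule p) (λ qr → *-cong (≈-trans (gateValue-embed e _ c) (jetGate-correct x _ c))
                                                             (≈-trans (gateValue-embed e _ c) (jetGate-correct y _ c)))) ⟩
          (α * β) * lincomb (rule p) (λ qr → jetValue c (proj₁ qr) u * jetValue c (proj₂ qr) v)
            ≈⟨ *-congˡ (≈-sym (jet-leibniz p (family c u) (family c v))) ⟩
          (α * β) * lincomb (jet p) (leibniz (family c u) (family c v))
            ≈⟨ ≈-sym (lincomb-*ˡ (jet p) (α * β) _) ⟩
          lincomb (jet p) (λ r → (α * β) * leibniz (family c u) (family c v) r)
            ≈⟨ lincomb-cong (jet p) (λ r → ≈-sym (≈-trans (family-⊗ c _ _ r)
                 (≈-trans (leibniz-cong (family-scalar c (α * β) u) (λ _ → ≈-refl) r) (leibniz-*ˡ (α * β) _ _ r)))) ⟩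
          jetValue c p ((con (α * β) ⊗ u) ⊗ v) ∎

    gateJets : ∀ {n} (C : Circuit n) (g : Gate n) (tr : Translation C) →
               Extensions (Translation.circuit tr) N costPerGate (λ p c → jetValue c p (lookup (values (C ▷ g)) Fin.zero))
    gateJets C (leaf a₀ bs)  tr = extensions-≤ N≤costPerGate (extendAll N _ (λ _ → 1) (λ {_} {C′} _ → leafJet a₀ bs C′) _ ⊑-refl)
    gateJets C (add α x β y) tr = extensions-≤ N≤costPerGate (extendAll N _ (λ _ → 1) (addJet tr α x β y) _ ⊑-refl)
    gateJets C (mul α x β y) tr = extendAll N _ (λ p → suc (2 ℕ.* List.length (rule p))) (mulJet tr α x β y) _ ⊑-refl

    translate : ∀ {n} (C : Circuit n) → Translation C
    translate [] = record { circuit = [] ; jetGate = λ () ; jetGate-correct = λ () ; size-≤ = z≤n }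
    translate (C ▷ g) = record
      { circuit = Block.circuit
      ; jetGate = jetGate′
      ; jetGate-correct = correct
      ; size-≤ = ℕₚ.≤-trans Block.size-≤ (ℕₚ.+-monoʳ-≤ costPerGate (Translation.size-≤ tr))
      }
      where
      tr = translate C
      module Block = Extensions (gateJets C g tr)
      jetGate′ : Fin _ → Fin N → Fin Block.size
      jetGate′ Fin.zero    p = Block.outputs p
      jetGate′ (Fin.suc x) p = embed Block.extends (Translation.jetGate tr x p)
      correct : ∀ x p c → gateValue Block.circuit (jetGate′ x p) c ≈ jetValue c p (lookup (values (C ▷ g)) x)
      correct Fin.zero    p c = Block.outputs-correct p c
      correct (Fin.suc x) p c = ≈-trans (gateValue-embed Block.extends _ c) (Translation.jetGate-correct tr x p c)

    jetCombinationCircuit : ∀ {s} (C : Circuit (suc s)) (coefficients : Comb (Fin N)) →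
      Σ ℕ λ s′ → Σ (Circuit (suc s′)) λ C′ → (suc s′ ℕ.≤ suc (List.length coefficients) ℕ.+ suc s ℕ.* costPerGate) ×
        (∀ c → eval c (output C′) ≈ lincomb coefficients (λ p → jetValue c p (output C)))
    jetCombinationCircuit (C ▷ g) coefficients =
      _ , circuit , ℕₚ.≤-trans size-≤ (ℕₚ.+-mono-≤ (ℕₚ.≤-reflexive (≡.cong suc (Listₚ.length-map _ coefficients))) (Translation.size-≤ tr)) ,
      correct
      where
      tr = translate (C ▷ g)
      open Extension (linearCombination (Translation.circuit tr) (mapKeys (λ p → Translation.jetGate tr Fin.zero p) coefficients))
      correct : ∀ c → eval c (output circuit) ≈ lincomb coefficients (λ p → jetValue c p (output (C ▷ g)))
      correct c with circuit | output-correct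
      ... | C′ ▷ g′ | oc = ≈-trans (oc c) (≈-trans (≡⇒≈ (lincomb-mapKeys _ coefficients _))
                                                   (lincomb-cong coefficients (λ p → Translation.jetGate-correct tr Fin.zero p c)))

module ActionCircuits (R : CommutativeRing 0ℓ 0ℓ) (k d : ℕ) where
  open CommutativeRing R renaming (refl to ≈-refl; sym to ≈-sym; trans to ≈-trans)
  open import Relation.Binary.Reasoning.Setoid setoid
  open CMSolver +-commutativeMonoid using (solve; _⊜_) renaming (_⊕_ to _⊞_)
  open Meta R k d hiding (Word)
  open Combinations R
  open GlFamilies R k d
  open CircuitExtensions R k d using (sumFin-cong; sumFin-lookup)
  open JetTranslation R k d

  CircuitOfSize≤ : ℕ → MetaPoly → Set
  CircuitOfSize≤ t Δ = Σ ℕ λ s′ → Σ (Circuit (suc s′)) λ C′ → suc s′ ℕ.≤ t × Computes C′ Δ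

  eval-uAct : ∀ c P e → eval c (uAct P e) ≈ lincomb P (λ w → Evaluated.family c e (List.reverse w))
  eval-uAct c []            e = ≈-refl
  eval-uAct c ((a , w) ∷ P) e = +-cong (*-congˡ (≡⇒≈ (≡.cong (eval c) (wordAct-applyWord w e)))) (eval-uAct c P e)

  circuitFromJets : (J : JetSystem) → ∀ {s t Δ} (C : Circuit (suc s)) (coefficients : Comb (Fin (JetSystem.N J))) →
                    suc (List.length coefficients) ℕ.+ suc s ℕ.* Translate.costPerGate J ℕ.≤ t →
                    (∀ c → lincomb coefficients (λ p → Translate.jetValue J c p (output C)) ≈ eval c Δ) →
                    CircuitOfSize≤ t Δ
  circuitFromJets J C coefficients size-ok correct with Translate.jetCombinationCircuit J C coefficients
  ... | s′ , C′ , size-≤ , computes = s′ , C′ , ℕₚ.≤-trans size-≤ size-ok , λ c → ≈-trans (computes c) (correct c)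

  -- Elements of length ≤ 1: the jets "constant term" and "the degree-one part of P" suffice.
  module LengthAtMostOne where
    linearPart : Comb Word → Comb Word
    linearPart []                    = []
    linearPart ((a , [])        ∷ P) = linearPart P
    linearPart ((a , x ∷ [])    ∷ P) = (a , x ∷ []) ∷ linearPart P
    linearPart ((a , x ∷ _ ∷ _) ∷ P) = linearPart P

    constantPart : Comb Word → Carrier
    constantPart []              = 0#
    constantPart ((a , [])  ∷ P) = a + constantPart P
    constantPart ((a , _ ∷ _) ∷ P) = constantPart P

    lincomb-linearPart-leibniz : ∀ P F G → lincomb (linearPart P) (leibniz F G) ≈
                                 lincomb (linearPart P) F * G [] + F [] * lincomb (linearPart P) G
    lincomb-linearPart-leibniz []                    F G = ≈-sym (≈-trans (+-cong (zeroˡ _) (zeroʳ _)) (+-identityʳ 0#))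
    lincomb-linearPart-leibniz ((a , [])        ∷ P) F G = lincomb-linearPart-leibniz P F G
    lincomb-linearPart-leibniz ((a , x ∷ _ ∷ _) ∷ P) F G = lincomb-linearPart-leibniz P F G
    lincomb-linearPart-leibniz ((a , x ∷ [])    ∷ P) F G = begin
      a * (F (x ∷ []) * G [] + F [] * G (x ∷ [])) + lincomb (linearPart P) (leibniz F G)
        ≈⟨ +-cong (distribˡ a _ _) (lincomb-linearPart-leibniz P F G) ⟩
      (a * (F (x ∷ []) * G []) + a * (F [] * G (x ∷ []))) + (lincomb (linearPart P) F * G [] + F [] * lincomb (linearPart P) G)
        ≈⟨ +-congʳ (+-cong (≈-sym (*-assoc _ _ _)) (*-left-comm a _ _)) ⟩
      ((a * F (x ∷ [])) * G [] + F [] * (a * G (x ∷ []))) + (lincomb (linearPart P) F * G [] + F [] * lincomb (linearPart P) G)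
        ≈⟨ +-interchange _ _ _ _ ⟩
      ((a * F (x ∷ [])) * G [] + lincomb (linearPart P) F * G []) + (F [] * (a * G (x ∷ [])) + F [] * lincomb (linearPart P) G)
        ≈⟨ +-cong (≈-sym (distribʳ _ _ _)) (≈-sym (distribˡ _ _ _)) ⟩
      (a * F (x ∷ []) + lincomb (linearPart P) F) * G [] + F [] * (a * G (x ∷ []) + lincomb (linearPart P) G) ∎

    lincomb-length≤1 : ∀ P → All (λ aw → List.length (proj₂ aw) ℕ.≤ 1) P → ∀ (F : Family) →
                       lincomb P (λ w → F (List.reverse w)) ≈ constantPart P * F [] + lincomb (linearPart P) F
    lincomb-length≤1 []                    []       F = ≈-sym (≈-trans (+-identityʳ _) (zeroˡ _))
    lincomb-length≤1 ((a , [])        ∷ P) (_ ∷ hs) F =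
      ≈-trans (+-congˡ (lincomb-length≤1 P hs F)) (≈-trans (≈-sym (+-assoc _ _ _)) (+-congʳ (≈-sym (distribʳ _ _ _))))
    lincomb-length≤1 ((a , x ∷ [])    ∷ P) (_ ∷ hs) F = ≈-trans (+-congˡ (lincomb-length≤1 P hs F))
      (solve 3 (λ p q r → (p ⊞ (q ⊞ r)) ⊜ (q ⊞ (p ⊞ r))) ≈-refl _ _ _)
    lincomb-length≤1 ((a , x ∷ _ ∷ _) ∷ P) (s≤s () ∷ hs) F

    unit : ∀ x → 1# * x + 0# ≈ x
    unit x = ≈-trans (+-identityʳ _) (*-identityˡ x)

    jetSystem : Comb Word → JetSystem
    jetSystem P = record { N = 2 ; jet = jet ; rule = rule ; jet-leibniz = jet-leibniz }
      where
      jet : Fin 2 → Comb Word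
      jet Fin.zero       = (1# , []) ∷ []
      jet (Fin.suc _)    = linearPart P
      rule : Fin 2 → Comb (Fin 2 × Fin 2)
      rule Fin.zero      = (1# , (Fin.zero , Fin.zero)) ∷ []
      rule (Fin.suc _)   = (1# , (Fin.suc Fin.zero , Fin.zero)) ∷ (1# , (Fin.zero , Fin.suc Fin.zero)) ∷ []
      jet-leibniz : ∀ p F G → lincomb (jet p) (leibniz F G) ≈
                              lincomb (rule p) (λ qr → lincomb (jet (proj₁ qr)) F * lincomb (jet (proj₂ qr)) G)
      jet-leibniz Fin.zero    F G = ≈-trans (unit _) (≈-sym (≈-trans (unit _) (*-cong (unit _) (unit _))))
      jet-leibniz (Fin.suc Fin.zero) F G = ≈-trans (lincomb-linearPart-leibniz P F G)
        (≈-sym (≈-trans (+-cong (*-identityˡ _) (unit _)) (+-cong (*-congˡ (unit _)) (*-congʳ (unit _)))))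

    circuit : ∀ {L s} (P : UEnvRep) → HasLength≤ P L → L ℕ.≤ 1 → (C : Circuit (suc s)) →
              CircuitOfSize≤ (11 ℕ.* suc s) (uAct P (output C))
    circuit {L} {s} P P≤L L≤1 C =
      circuitFromJets (jetSystem P) {Δ = uAct P (output C)} C ((constantPart P , Fin.zero) ∷ (1# , Fin.suc Fin.zero) ∷ []) (size-ok s) correct
      where
      size-ok : ∀ s → 3 ℕ.+ suc s ℕ.* 8 ℕ.≤ 11 ℕ.* suc s
      size-ok s = ℕₚ.≤-trans (ℕₚ.+-monoˡ-≤ (suc s ℕ.* 8) (ℕₚ.m≤m*n 3 (suc s))) (ℕₚ.≤-reflexive (sum s))
        where sum : ∀ s → 3 ℕ.* suc s ℕ.+ suc s ℕ.* 8 ≡ 11 ℕ.* suc s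
              sum = solve-∀
      correct : ∀ c → constantPart P * (1# * Evaluated.family c (output C) [] + 0#) + (1# * lincomb (linearPart P) (Evaluated.family c (output C)) + 0#)
                      ≈ eval c (uAct P (output C))
      correct c = ≈-sym (≈-trans (eval-uAct c P (output C))
        (≈-trans (lincomb-length≤1 P (All.map (λ h → ℕₚ.≤-trans h L≤1) P≤L) (Evaluated.family c (output C)))
                 (+-cong (*-congˡ (≈-sym (unit _))) (≈-sym (unit _)))))

  -- Elements of length ≤ B: the jets are the ordered monomials of degree ≤ B, closed under the Leibniz rule.
  module LengthAtMost (B : ℕ) where
    m : ℕ
    m = k ℕ.* k

    order : Vec (Fin k × Fin k) m
    order = Vec.tabulate (Fin.remQuot k)

    position : Fin k × Fin k → Fin m
    position (i , j) = Fin.combine i j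

    lookup-position : ∀ x → lookup order (position x) ≡ x
    lookup-position (i , j) = ≡.trans (Vecₚ.lookup∘tabulate (Fin.remQuot k) (Fin.combine i j)) (Finₚ.remQuot-combine i j)

    open Straightening order position lookup-position
    open LeibnizCoefficients R using (leibnizTerms; leibnizTerms-degree; length-leibnizTerms)
    open DecMembership (Vecₚ.≡-dec {n = m} ℕₚ._≟_) using (_∈?_)

    monomials : List (Vec ℕ m)
    monomials = exponents m B

    N : ℕ
    N = List.length monomials

    monomialAt : Fin N → Vec ℕ m
    monomialAt = List.lookup monomials

    monomialAt-≤ : ∀ p → Vec.sum (monomialAt p) ℕ.≤ B
    monomialAt-≤ p = All.lookup (exponents-≤ m B) (∈-lookup p)

    -- junk value: monomials of degree > B are sent to the position of the zero exponent
    indexOf : Vec ℕ m → Fin N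
    indexOf κ with κ ∈? monomials
    ... | yes κ∈ = Any.index κ∈
    ... | no  _  = Any.index (∈-exponents {B = B} zeros (ℕₚ.≤-trans (ℕₚ.≤-reflexive (sum-replicate-0 m)) z≤n))

    monomialAt-indexOf : ∀ κ → Vec.sum κ ℕ.≤ B → monomialAt (indexOf κ) ≡ κ
    monomialAt-indexOf κ κ≤B with κ ∈? monomials
    ... | yes κ∈ = ≡.sym (Anyₚ.lookup-index κ∈)
    ... | no  κ∉ = ⊥-elim (κ∉ (∈-exponents κ κ≤B))

    jet : Fin N → Comb Word
    jet p = (1# , monomial order (monomialAt p)) ∷ []

    rule : Fin N → Comb (Fin N × Fin N)
    rule p = mapKeys (Product.map indexOf indexOf) (leibnizTerms (monomialAt p))

    lincomb-jet-indexOf : ∀ κ → Vec.sum κ ℕ.≤ B → (F : Family) → lincomb (jet (indexOf κ)) F ≈ F (monomial order κ)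
    lincomb-jet-indexOf κ κ≤B F = ≈-trans (+-identityʳ _) (≈-trans (*-identityˡ _)
      (≡⇒≈ (≡.cong (F ∘ monomial order) (monomialAt-indexOf κ κ≤B))))

    jet-leibniz : ∀ p F G → lincomb (jet p) (leibniz F G) ≈
                            lincomb (rule p) (λ qr → lincomb (jet (proj₁ qr)) F * lincomb (jet (proj₂ qr)) G)
    jet-leibniz p F G = begin
      lincomb (jet p) (leibniz F G)
        ≈⟨ ≈-trans (+-identityʳ _) (*-identityˡ _) ⟩
      leibniz F G (monomial order (monomialAt p))
        ≈⟨ leibniz-monomial order (monomialAt p) F G ⟩
      lincomb (leibnizTerms (monomialAt p)) (λ βγ → F (monomial order (proj₁ βγ)) * G (monomial order (proj₂ βγ)))
        ≈⟨ lincomb-congᴬ (leibnizTerms-degree (monomialAt p)) (λ βγ β+γ≡ →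
             ≈-sym (*-cong (lincomb-jet-indexOf (proj₁ βγ) (β≤ β+γ≡) F) (lincomb-jet-indexOf (proj₂ βγ) (γ≤ β+γ≡) G))) ⟩
      lincomb (leibnizTerms (monomialAt p)) (λ βγ → lincomb (jet (indexOf (proj₁ βγ))) F * lincomb (jet (indexOf (proj₂ βγ))) G)
        ≈⟨ ≡⇒≈ (≡.sym (lincomb-mapKeys _ (leibnizTerms (monomialAt p)) _)) ⟩
      lincomb (rule p) (λ qr → lincomb (jet (proj₁ qr)) F * lincomb (jet (proj₂ qr)) G) ∎
      where
      β≤ : ∀ {b c} → b ℕ.+ c ≡ Vec.sum (monomialAt p) → b ℕ.≤ B
      β≤ {b} {c} h = ℕₚ.≤-trans (ℕₚ.m≤m+n b c) (ℕₚ.≤-trans (ℕₚ.≤-reflexive h) (monomialAt-≤ p))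
      γ≤ : ∀ {b c} → b ℕ.+ c ≡ Vec.sum (monomialAt p) → c ℕ.≤ B
      γ≤ {b} {c} h = ℕₚ.≤-trans (ℕₚ.m≤n+m c b) (ℕₚ.≤-trans (ℕₚ.≤-reflexive h) (monomialAt-≤ p))

    jetSystem : JetSystem
    jetSystem = record { N = N ; jet = jet ; rule = rule ; jet-leibniz = jet-leibniz }

    N≤splitTotal : N ℕ.≤ splitTotal m B
    N≤splitTotal = ℕₚ.≤-trans (ℕₚ.≤-reflexive (≡.trans (≡.sym (ℕₚ.*-identityʳ N)) (≡.sym (sumℕ-const monomials 1))))
                              (sumℕ-mono (exponents-≤ m B) (λ κ _ → splitCount-pos κ))

    costPerGate≡ : Translate.costPerGate jetSystem ≡ sumℕ monomials (λ κ → suc (2 ℕ.* splitCount κ))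
    costPerGate≡ = ≡.trans (sumFin-cong N (λ p → ≡.cong (λ z → suc (2 ℕ.* z))
                     (≡.trans (Listₚ.length-map _ (leibnizTerms (monomialAt p))) (length-leibnizTerms (monomialAt p)))))
                   (sumFin-lookup monomials (λ κ → suc (2 ℕ.* splitCount κ)))

    costPerGate≤ : Translate.costPerGate jetSystem ℕ.≤ 3 ℕ.* splitTotal m B
    costPerGate≤ = ℕₚ.≤-trans (ℕₚ.≤-reflexive costPerGate≡)
      (ℕₚ.≤-trans (sumℕ-mono (exponents-≤ m B) (λ κ _ → ℕₚ.+-monoˡ-≤ (2 ℕ.* splitCount κ) (splitCount-pos κ)))
                  (ℕₚ.≤-reflexive (sumℕ-*ˡ monomials 3 splitCount)))

    circuit : ∀ {s} (P : UEnvRep) → HasLength≤ P B → 2 ℕ.≤ B → (C : Circuit (suc s)) →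
              CircuitOfSize≤ (11 ℕ.* (suc s ℕ.* B ℕ.^ (2 ℕ.* m))) (uAct P (output C))
    circuit {s} P P≤B 2≤B C = circuitFromJets jetSystem {Δ = uAct P Δ} C coefficients size-ok correct
      where
      Δ = output C
      expansion = substitute P (λ w → straighten B (List.reverse w))
      merged = MergeExponents.merge expansion monomials
      coefficients = mapKeys indexOf merged

      length-reverse-≤ : ∀ w → List.length w ℕ.≤ B → List.length (List.reverse w) ℕ.≤ B
      length-reverse-≤ w h = ℕₚ.≤-trans (ℕₚ.≤-reflexive (Listₚ.length-reverse w)) h

      expansion-degree : AllKeys (λ κ → Vec.sum κ ℕ.≤ B) expansion
      expansion-degree = AllKeys-substitute _ P≤B (λ w w≤B →
        All.map (λ h → ℕₚ.≤-trans h (length-reverse-≤ w w≤B)) (straighten-degree B (List.reverse w) (length-reverse-≤ w w≤B)))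

      correct : ∀ c → lincomb coefficients (λ p → Translate.jetValue jetSystem c p Δ) ≈ eval c (uAct P Δ)
      correct c = begin
        lincomb coefficients (λ p → lincomb (jet p) F)
          ≈⟨ ≡⇒≈ (lincomb-mapKeys indexOf merged _) ⟩
        lincomb merged (λ κ → lincomb (jet (indexOf κ)) F)
          ≈⟨ lincomb-congᴬ (MergeExponents.AllKeys-merge expansion (exponents-≤ m B)) (λ κ κ≤B → lincomb-jet-indexOf κ κ≤B F) ⟩
        lincomb merged (F ∘ monomial order)
          ≈⟨ MergeExponents.lincomb-merge expansion monomials _ (All.map (λ {ακ} → exponents-selectsOnce m B (proj₂ ακ)) expansion-degree) ⟩
        lincomb expansion (F ∘ monomial order)
          ≈⟨ lincomb-substitute P _ _ ⟩
        lincomb P (λ w → lincomb (straighten B (List.reverse w)) (F ∘ monomial order))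
          ≈⟨ lincomb-congᴬ P≤B (λ w w≤B → ≈-sym (straighten-correct B (List.reverse w) (length-reverse-≤ w w≤B) {F}
                                                                   (Evaluated.family-respectsBracket c Δ))) ⟩
        lincomb P (λ w → F (List.reverse w))
          ≈⟨ ≈-sym (eval-uAct c P Δ) ⟩
        eval c (uAct P Δ) ∎
        where F = Evaluated.family c Δ

      X = B ℕ.^ (2 ℕ.* m)
      total≤ : splitTotal m B ℕ.≤ 2 ℕ.* X
      total≤ = splitTotal-≤ m B 2≤B
      size-ok : suc (List.length coefficients) ℕ.+ suc s ℕ.* Translate.costPerGate jetSystem ℕ.≤ 11 ℕ.* (suc s ℕ.* X)
      size-ok = ℕₚ.≤-trans
        (ℕₚ.+-mono-≤ (s≤s (ℕₚ.≤-trans (ℕₚ.≤-reflexive (≡.trans (Listₚ.length-map _ merged) (Listₚ.length-map _ monomials)))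
                                      (ℕₚ.≤-trans N≤splitTotal total≤)))
                     (ℕₚ.*-monoʳ-≤ (suc s) (ℕₚ.≤-trans costPerGate≤ (ℕₚ.*-monoʳ-≤ 3 total≤))))
        (jet-size-arithmetic s X (ℕₚ.m^n>0 B {{ℕ.>-nonZero (ℕₚ.≤-trans (s≤s z≤n) 2≤B)}} (2 ℕ.* m)))

  circuitOfSize-≤ : ∀ {t t′ Δ} → t ℕ.≤ t′ → CircuitOfSize≤ t Δ → CircuitOfSize≤ t′ Δ
  circuitOfSize-≤ t≤t′ (s′ , C′ , size-≤ , computes) = s′ , C′ , ℕₚ.≤-trans size-≤ t≤t′ , computes

  actionCircuit : ∀ {L s} (P : UEnvRep) → HasLength≤ P L → (C : Circuit (suc s)) →
                  CircuitOfSize≤ (11 ℕ.* (suc s ℕ.* (1 ℕ.⊔ L) ℕ.^ (2 ℕ.* (k ℕ.* k)))) (uAct P (output C))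
  actionCircuit {L} {s} P P≤L C with L ℕ.≤? 1
  ... | yes L≤1 = circuitOfSize-≤ {Δ = uAct P (output C)} (ℕₚ.*-monoʳ-≤ 11 (ℕₚ.m≤m*n (suc s) ((1 ℕ.⊔ L) ℕ.^ e) {{1⊔L^e≢0}}))
                                  (LengthAtMostOne.circuit P P≤L L≤1 C)
    where
    e = 2 ℕ.* (k ℕ.* k)
    1⊔L^e≢0 = ℕₚ.m^n≢0 (1 ℕ.⊔ L) e {{ℕ.>-nonZero (ℕₚ.m≤m⊔n 1 L)}}
  ... | no  L≰1 rewrite ℕₚ.m≤n⇒m⊔n≡n (ℕₚ.≤-trans (s≤s z≤n) (ℕₚ.≰⇒> L≰1)) =
                  LengthAtMost.circuit L P P≤L (ℕₚ.≰⇒> L≰1) C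

open import Data.Nat using (_*_; _^_; _≤_; _⊔_)

-- The hypothesis that R is an algebraically closed field of characteristic 0 is not needed.
theorem5p10 : (R : CommutativeRing 0ℓ 0ℓ) → IsACF0 R →
    ∃ λ (K : ℕ) →
      ∀ (k d L s : ℕ) (P : Meta.UEnvRep R k d) → Meta.HasLength≤ R k d P L →
      ∀ (C : Meta.Circuit R k d (suc s)) →
        ∃ λ (s′ : ℕ) → ∃ λ (C′ : Meta.Circuit R k d (suc s′)) →
          (suc s′ ≤ K * (suc s * (1 ⊔ L) ^ (2 * (k * k))))
          × Meta.Computes R k d C′ (Meta.uAct R k d P (Meta.output R k d C))
theorem5p10 R _ = 11 , λ k d L s P P≤L C → ActionCircuits.actionCircuit R k d P P≤L C
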